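{- There is no $4$-uniform Šoltés' hypergraph of order $9$.
   Context: A hypergraph $H=(V,E)$ consists of a finite vertex set $V$ and a set $E$ of distinct subsets of $V$ (hyperedges). $H$ is $k$-uniform if every hyperedge has exactly $k$ elements. The order of $H$ is $|V|$. For $u,w\in V$, the distance $d_H(u,w)$ is the least $\ell\ge 0$ such that there are vertices $u=x_0,\dots,x_\ell=w$ with $x_{i-1},x_i$ contained in a common hyperedge for each $i$ ($\infty$ if none exists); $H$ is connected if all distances are finite. $W(H)=\sum_{\{u,w\}\subseteq V,\,u\ne w} d_H(u,w)$. For $v\in V$, $H\setminus v$ has vertex set $V\setminus\{v\}$ and hyperedge set $\{e\in E: v\notin e\}$. A Šoltés' hypergraph is a connected hypergraph $H$ with $W(H\setminus v)=W(H)$ for every $v\in V$. -}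

module Defs where

open import Data.Nat using (ℕ; zero; suc; _+_; _≤_)
open import Data.Fin using (Fin; _≟_)
open import Data.Fin.Subset using (Subset; _∈_; ∣_∣)
open import Data.Fin.Subset.Properties using (_∈?_)
open import Data.List using (List; []; _∷_; map; filter; allFin)
open import Data.Nat.ListAction using (sum)
import Data.List.Membership.Propositional as LM
open import Data.List.Relation.Unary.All using (All)
open import Data.List.Relation.Unary.Unique.Propositional using (Unique)
open import Data.Product using (Σ; _×_)
open import Relation.Nullary using (¬?)
open import Relation.Binary.PropositionalEquality using (_≡_)

-- A hypergraph on vertex set Fin n is given by its list of hyperedges
-- (subsets of Fin n); distinctness of hyperedges is the hypothesis 'Unique'.
Hyperedges : ℕ → Set
Hyperedges n = List (Subset n)

Uniform : ∀ {n} → Hyperedges n → ℕ → Set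
Uniform E k = All (λ e → ∣ e ∣ ≡ k) E

data Walk {n : ℕ} (E : Hyperedges n) : Fin n → Fin n → ℕ → Set where
  here : ∀ {u} → Walk E u u zero
  step : ∀ {u x w ℓ} (e : Subset n) → e LM.∈ E → u ∈ e → x ∈ e →
         Walk E x w ℓ → Walk E u w (suc ℓ)

IsDist : ∀ {n} → Hyperedges n → Fin n → Fin n → ℕ → Set
IsDist E u w d = Walk E u w d × (∀ ℓ → Walk E u w ℓ → d ≤ ℓ)

-- Sum of f over unordered pairs of distinct positions of a list
-- (for a duplicate-free list: sum over 2-element subsets).
pairSum : ∀ {A : Set} → (A → A → ℕ) → List A → ℕ
pairSum f []       = 0
pairSum f (x ∷ xs) = sum (map (f x) xs) + pairSum f xs

WienerIs : ∀ {n} → Hyperedges n → List (Fin n) → ℕ → Set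
WienerIs {n} E vs W =
  Σ (Fin n → Fin n → ℕ) λ d →
    (∀ u w → u LM.∈ vs → w LM.∈ vs → IsDist E u w (d u w)) × (W ≡ pairSum d vs)

-- H \ v : vertices Fin n ∖ {v}, hyperedges not containing v.
deleteEdges : ∀ {n} → Fin n → Hyperedges n → Hyperedges n
deleteEdges v E = filter (λ e → ¬? (v ∈? e)) E

otherVertices : ∀ {n} → Fin n → List (Fin n)
otherVertices {n} v = filter (λ u → ¬? (u ≟ v)) (allFin n)

Soltes : ∀ {n} → Hyperedges n → Set
Soltes {n} E =
  Σ ℕ λ W → WienerIs E (allFin n) W × (∀ v → WienerIs (deleteEdges v E) (otherVertices v) W)

{-# OPTIONS --safe #-}
module Submission where

-- Two edges of H − v through vertices x, y that are
-- neither adjacent nor have a common neighbour are disjoint, so they cover V ∖ {v}, and a walk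
-- from x to y leaving the first edge gives a path of length 3: distances in H − v are decided
-- by adjacency and common neighbours. Summing W(H − v) = W(H) over the nine vertices and
-- comparing with W(H) ≥ Σ (1 + [x, y non-adjacent]) yields an identity in which the number X
-- of pairs at distance 3 in the graphs H − v must pay for a total slack S ≥ 0, so S ≤ X.
-- Every vertex carries slack at least 2, so S ≥ 18 and some H − v has pairs at distance 3;
-- take v with the most of them, so that S ≤ 9 · X(H − v). A pair at distance 3 in H − v yields
-- disjoint edges A, B avoiding v joined by an edge G, and X(H − v) = 2αβ where α, β count the
-- vertices of A, B on no edge of H − v meeting both A and B; thus α, β ≥ 1 and α + β ≤ 4.
-- Each case (α, β) contradicts the identity once the slack inside A ∩ G, B ∩ G and at v is
-- bounded from below.

open import Defs
open import Data.Empty using (⊥)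
open import Data.Fin using (Fin; zero; suc; _≟_)
import Data.Fin.Properties as Fin
open import Data.Fin.Subset using (Subset; _∈_; _∉_; ∣_∣; _⊆_; inside; outside)
open import Data.Fin.Subset.Properties using (_∈?_; ⊆-antisym; p⊂q⇒∣p∣<∣q∣)
open import Data.List using (List; []; _∷_; map; filter; tabulate; allFin)
import Data.List.Membership.Propositional as Membership
open import Data.List.Membership.Propositional using () renaming (_∈_ to _∈ˡ_)
open import Data.List.Membership.Propositional.Properties using (∈-filter⁺; ∈-filter⁻; ∈-allFin)
import Data.List.Relation.Unary.All as All
open import Data.List.Relation.Unary.AllPairs using ([]; _∷_)
open import Data.List.Relation.Unary.Any using (here; there; any?)
open import Data.List.Relation.Unary.Unique.Propositional using (Unique)
import Data.List.Relation.Unary.Unique.Propositional.Properties as Unique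
open import Data.Nat using (ℕ; zero; suc; _+_; _*_; _∸_; _≤_; _<_; z≤n; s≤s; _≤?_; _<?_)
open import Data.Nat.ListAction using (sum)
open import Data.Nat.Properties hiding (_≟_)
open import Algebra.Properties.Semiring.Sum +-*-semiring
  using (sum-cong-≗; ∑-distrib-+; ∑-comm; *-distribˡ-sum; *-distribʳ-sum)
  renaming (sum to ∑)
open import Data.Nat.Solver using (module +-*-Solver)
open +-*-Solver using (solve; _:+_; _:*_; _:=_; con)
open import Data.Product using (Σ; _×_; _,_; proj₁; proj₂; ∃-syntax)
open import Data.Sum using (_⊎_; inj₁; inj₂; [_,_]′)
open import Data.Vec using (_∷_; [])
open import Function using (_∘_; id)
open import Relation.Binary.PropositionalEquality
open import Relation.Nullary using (¬_; Dec; yes; no; contradiction)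
open import Relation.Nullary.Decidable using (_×-dec_; ¬?; decidable-stable; False; toWitnessFalse)
import Relation.Nullary.Decidable as Dec
open import Relation.Unary using (Pred; Decidable)

private variable
  n ℓ : ℕ
  T P Q : Set

𝟙 : Dec P → ℕ
𝟙 (yes _) = 1
𝟙 (no _)  = 0

𝟙≤1 : (d : Dec P) → 𝟙 d ≤ 1
𝟙≤1 (yes _) = s≤s z≤n
𝟙≤1 (no _)  = z≤n

𝟙-yes : (d : Dec P) → P → 𝟙 d ≡ 1
𝟙-yes (yes _) _ = refl
𝟙-yes (no ¬p) p = contradiction p ¬p

𝟙-no : (d : Dec P) → ¬ P → 𝟙 d ≡ 0
𝟙-no (yes p) ¬p = contradiction p ¬p
𝟙-no (no _)  _  = refl

𝟙-pos : (d : Dec P) → 1 ≤ 𝟙 d → P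
𝟙-pos (yes p) _ = p

𝟙-cong : (d : Dec P) (e : Dec Q) → (P → Q) → (Q → P) → 𝟙 d ≡ 𝟙 e
𝟙-cong (yes _) (yes _) _ _ = refl
𝟙-cong (yes p) (no ¬q) f _ = contradiction (f p) ¬q
𝟙-cong (no ¬p) (yes q) _ g = contradiction (g q) ¬p
𝟙-cong (no _)  (no _)  _ _ = refl

𝟙+𝟙¬ : (d : Dec P) → 𝟙 d + 𝟙 (¬? d) ≡ 1
𝟙+𝟙¬ (yes _) = refl
𝟙+𝟙¬ (no _)  = refl

𝟙-× : (d : Dec P) (e : Dec Q) → 𝟙 (d ×-dec e) ≡ 𝟙 d * 𝟙 e
𝟙-× (yes _) (yes _) = refl
𝟙-× (yes _) (no _)  = refl
𝟙-× (no _)  _       = refl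

n≤1⇒n*n≡n : ∀ a → a ≤ 1 → a * a ≡ a
n≤1⇒n*n≡n zero          _ = refl
n≤1⇒n*n≡n (suc zero)    _ = refl
n≤1⇒n*n≡n (suc (suc a)) (s≤s ())

*-pos⇒pos : ∀ a b → 1 ≤ a * b → 1 ≤ a × 1 ≤ b
*-pos⇒pos (suc a) (suc b) _  = s≤s z≤n , s≤s z≤n
*-pos⇒pos (suc a) zero    ab≥1 = contradiction (subst (1 ≤_) (*-zeroʳ a) ab≥1) λ ()

≰-by-computation : ∀ {m n} {m≰n : False (m ≤? n)} → ¬ m ≤ n
≰-by-computation {m≰n = m≰n} = toWitnessFalse m≰n

∑-mono : {f g : Fin n → ℕ} → (∀ i → f i ≤ g i) → ∑ f ≤ ∑ g
∑-mono {zero}  h = z≤n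
∑-mono {suc n} h = +-mono-≤ (h zero) (∑-mono (h ∘ suc))

∑-const : ∀ n c → ∑ {n} (λ _ → c) ≡ n * c
∑-const zero    c = refl
∑-const (suc n) c = cong (c +_) (∑-const n c)

∑-zero : ∀ n → ∑ {n} (λ _ → 0) ≡ 0
∑-zero n = trans (∑-const n 0) (*-zeroʳ n)

∑-<⇒∃-< : (f g : Fin n → ℕ) → ∑ f < ∑ g → ∃[ z ] (f z < g z)
∑-<⇒∃-< {suc n} f g h with f zero <? g zero
... | yes f₀<g₀ = zero , f₀<g₀
... | no  f₀≮g₀ with ∑-<⇒∃-< (f ∘ suc) (g ∘ suc)
                      (+-cancelˡ-< (g zero) _ _ (≤-<-trans (+-monoˡ-≤ _ (≮⇒≥ f₀≮g₀)) h))
...   | z , fz<gz = suc z , fz<gz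

∑-pos : (f : Fin n → ℕ) → 1 ≤ ∑ f → ∃[ i ] (1 ≤ f i)
∑-pos {n} f h = ∑-<⇒∃-< (λ _ → 0) f (subst (_< ∑ f) (sym (∑-zero n)) h)

∑-mono-tight : (f g : Fin n → ℕ) → (∀ i → f i ≤ g i) → ∑ g ≤ ∑ f → ∀ i → g i ≤ f i
∑-mono-tight {suc n} f g f≤g ∑g≤∑f zero =
  +-cancelʳ-≤ _ _ _ (≤-trans ∑g≤∑f (+-monoʳ-≤ (f zero) (∑-mono (f≤g ∘ suc))))
∑-mono-tight {suc n} f g f≤g ∑g≤∑f (suc i) =
  ∑-mono-tight (f ∘ suc) (g ∘ suc) (f≤g ∘ suc)
    (+-cancelˡ-≤ (g zero) _ _ (≤-trans ∑g≤∑f (+-monoˡ-≤ _ (f≤g zero)))) i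

argmax : (f : Fin (suc n) → ℕ) → ∃[ v ] (∀ u → f u ≤ f v)
argmax {zero}  f = zero , λ { zero → ≤-refl }
argmax {suc n} f with argmax (f ∘ suc)
... | v , max with f zero ≤? f (suc v)
...   | yes f₀≤ = suc v , λ { zero → f₀≤ ; (suc u) → max u }
...   | no  f₀≰ = zero  , λ { zero → ≤-refl ; (suc u) → ≤-trans (max u) (<⇒≤ (≰⇒> f₀≰)) }

𝟙≢ : Fin n → Fin n → ℕ
𝟙≢ i j = 𝟙 (¬? (i ≟ j))

𝟙≢-yes : {i j : Fin n} → i ≢ j → 𝟙≢ i j ≡ 1
𝟙≢-yes {i = i} {j} = 𝟙-yes (¬? (i ≟ j))

𝟙≢-refl : (i : Fin n) → 𝟙≢ i i ≡ 0
𝟙≢-refl i = 𝟙-no (¬? (i ≟ i)) (λ i≢i → i≢i refl)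

𝟙≢-sym : (i j : Fin n) → 𝟙≢ i j ≡ 𝟙≢ j i
𝟙≢-sym i j = 𝟙-cong (¬? (i ≟ j)) (¬? (j ≟ i)) (λ h → h ∘ sym) (λ h → h ∘ sym)

∑-𝟙≟ : (x : Fin n) → ∑ (λ i → 𝟙 (i ≟ x)) ≡ 1
∑-𝟙≟ {suc n} zero = cong suc (∑-zero n)
∑-𝟙≟ {suc n} (suc x) =
  trans (sum-cong-≗ (λ i → 𝟙-cong (suc i ≟ suc x) (i ≟ x) Fin.suc-injective (cong suc))) (∑-𝟙≟ x)

∑-pick : (g : Fin n → ℕ) (x : Fin n) → ∑ (λ i → g i * 𝟙 (i ≟ x)) ≡ g x
∑-pick g x = begin
  ∑ (λ i → g i * 𝟙 (i ≟ x))  ≡⟨ sum-cong-≗ only-x ⟩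
  ∑ (λ i → g x * 𝟙 (i ≟ x))  ≡⟨ *-distribˡ-sum (g x) (λ i → 𝟙 (i ≟ x)) ⟨
  g x * ∑ (λ i → 𝟙 (i ≟ x))  ≡⟨ cong (g x *_) (∑-𝟙≟ x) ⟩
  g x * 1                    ≡⟨ *-identityʳ (g x) ⟩
  g x                        ∎
  where
  open ≡-Reasoning
  only-x : ∀ i → g i * 𝟙 (i ≟ x) ≡ g x * 𝟙 (i ≟ x)
  only-x i with i ≟ x
  ... | yes refl = refl
  ... | no  _    = trans (*-zeroʳ (g i)) (sym (*-zeroʳ (g x)))

∑-split-at : (g : Fin n → ℕ) (x : Fin n) → ∑ g ≡ g x + ∑ (λ i → g i * 𝟙≢ i x)
∑-split-at g x = begin
  ∑ g                                                    ≡⟨ sum-cong-≗ split ⟩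
  ∑ (λ i → g i * 𝟙 (i ≟ x) + g i * 𝟙≢ i x)                ≡⟨ ∑-distrib-+ (λ i → g i * 𝟙 (i ≟ x)) (λ i → g i * 𝟙≢ i x) ⟩
  ∑ (λ i → g i * 𝟙 (i ≟ x)) + ∑ (λ i → g i * 𝟙≢ i x)      ≡⟨ cong (_+ ∑ (λ i → g i * 𝟙≢ i x)) (∑-pick g x) ⟩
  g x + ∑ (λ i → g i * 𝟙≢ i x)                           ∎
  where
  open ≡-Reasoning
  split : ∀ i → g i ≡ g i * 𝟙 (i ≟ x) + g i * 𝟙≢ i x
  split i = begin
    g i                                ≡⟨ *-identityʳ (g i) ⟨
    g i * 1                            ≡⟨ cong (g i *_) (𝟙+𝟙¬ (i ≟ x)) ⟨
    g i * (𝟙 (i ≟ x) + 𝟙≢ i x)          ≡⟨ *-distribˡ-+ (g i) _ _ ⟩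
    g i * 𝟙 (i ≟ x) + g i * 𝟙≢ i x      ∎

∑-split-at₂ : (g : Fin n → ℕ) (x y : Fin n) → x ≢ y →
              ∑ g ≡ g x + g y + ∑ (λ i → g i * 𝟙≢ i x * 𝟙≢ i y)
∑-split-at₂ g x y x≢y = begin
  ∑ g                                                   ≡⟨ ∑-split-at g x ⟩
  g x + ∑ (λ i → g i * 𝟙≢ i x)                          ≡⟨ cong (g x +_) (∑-split-at _ y) ⟩
  g x + (g y * 𝟙≢ y x + ∑ (λ i → g i * 𝟙≢ i x * 𝟙≢ i y)) ≡⟨ cong (λ a → g x + (g y * a + rest)) (𝟙≢-yes (x≢y ∘ sym)) ⟩
  g x + (g y * 1 + ∑ (λ i → g i * 𝟙≢ i x * 𝟙≢ i y))     ≡⟨ cong (λ a → g x + (a + rest)) (*-identityʳ (g y)) ⟩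
  g x + (g y + ∑ (λ i → g i * 𝟙≢ i x * 𝟙≢ i y))         ≡⟨ +-assoc (g x) (g y) _ ⟨
  g x + g y + ∑ (λ i → g i * 𝟙≢ i x * 𝟙≢ i y)           ∎
  where
  open ≡-Reasoning
  rest : ℕ
  rest = ∑ (λ i → g i * 𝟙≢ i x * 𝟙≢ i y)

term≤∑ : (f : Fin n → ℕ) (i : Fin n) → f i ≤ ∑ f
term≤∑ f i = ≤-trans (m≤m+n (f i) _) (≤-reflexive (sym (∑-split-at f i)))

two-terms≤∑ : (f : Fin n → ℕ) (i j : Fin n) → i ≢ j → f i + f j ≤ ∑ f
two-terms≤∑ f i j i≢j = ≤-trans (m≤m+n (f i + f j) _) (≤-reflexive (sym (∑-split-at₂ f i j i≢j)))

three-terms≤∑ : (f : Fin n → ℕ) (i j k : Fin n) → i ≢ j → i ≢ k → j ≢ k → f i + f j + f k ≤ ∑ f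
three-terms≤∑ f i j k i≢j i≢k j≢k = begin
  f i + f j + f k                                    ≡⟨ cong (f i + f j +_) fk ⟨
  f i + f j + f k * 𝟙≢ k i * 𝟙≢ k j                  ≤⟨ +-monoʳ-≤ (f i + f j) (term≤∑ _ k) ⟩
  f i + f j + ∑ (λ l → f l * 𝟙≢ l i * 𝟙≢ l j)        ≡⟨ ∑-split-at₂ f i j i≢j ⟨
  ∑ f                                                ∎
  where
  open ≤-Reasoning
  fk : f k * 𝟙≢ k i * 𝟙≢ k j ≡ f k
  fk rewrite 𝟙≢-yes (i≢k ∘ sym) | 𝟙≢-yes (j≢k ∘ sym) = trans (*-identityʳ (f k * 1)) (*-identityʳ (f k))

∑≥2⇒∃≢ : (f : Fin n → ℕ) → (∀ i → f i ≤ 1) → 2 ≤ ∑ f → ∀ v → ∃[ x ] (1 ≤ f x × x ≢ v)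
∑≥2⇒∃≢ f f≤1 ∑≥2 v =
  let rest≥1 = +-cancelˡ-≤ 1 1 _ (≤-trans ∑≥2 (≤-trans (≤-reflexive (∑-split-at f v)) (+-monoˡ-≤ _ (f≤1 v))))
      (x , term≥1) = ∑-pos (λ z → f z * 𝟙≢ z v) rest≥1
      (fx≥1 , 𝟙≢≥1) = *-pos⇒pos (f x) (𝟙≢ x v) term≥1
  in x , fx≥1 , 𝟙-pos (¬? (x ≟ v)) 𝟙≢≥1

∑-𝟙≢ : (x : Fin (suc n)) → ∑ (λ i → 𝟙≢ i x) ≡ n
∑-𝟙≢ {n} x = suc-injective (begin
  suc (∑ (λ i → 𝟙≢ i x))                         ≡⟨ cong (_+ ∑ (λ i → 𝟙≢ i x)) (∑-𝟙≟ x) ⟨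
  ∑ (λ i → 𝟙 (i ≟ x)) + ∑ (λ i → 𝟙≢ i x)          ≡⟨ ∑-distrib-+ (λ i → 𝟙 (i ≟ x)) (λ i → 𝟙≢ i x) ⟨
  ∑ (λ i → 𝟙 (i ≟ x) + 𝟙≢ i x)                    ≡⟨ sum-cong-≗ (λ i → 𝟙+𝟙¬ (i ≟ x)) ⟩
  ∑ {suc n} (λ _ → 1)                            ≡⟨ ∑-const (suc n) 1 ⟩
  suc n * 1                                      ≡⟨ *-identityʳ (suc n) ⟩
  suc n                                          ∎)
  where open ≡-Reasoning

∑₂ : (Fin n → Fin n → ℕ) → ℕ
∑₂ f = ∑ (λ i → ∑ (f i))

∑₂-cong : {f g : Fin n → Fin n → ℕ} → (∀ i j → f i j ≡ g i j) → ∑₂ f ≡ ∑₂ g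
∑₂-cong f≡g = sum-cong-≗ (λ i → sum-cong-≗ (f≡g i))

∑₂-mono : {f g : Fin n → Fin n → ℕ} → (∀ i j → f i j ≤ g i j) → ∑₂ f ≤ ∑₂ g
∑₂-mono f≤g = ∑-mono (λ i → ∑-mono (f≤g i))

∑₂-distrib-+ : (f g : Fin n → Fin n → ℕ) → ∑₂ (λ i j → f i j + g i j) ≡ ∑₂ f + ∑₂ g
∑₂-distrib-+ f g =
  trans (sum-cong-≗ (λ i → ∑-distrib-+ (f i) (g i))) (∑-distrib-+ (λ i → ∑ (f i)) (λ i → ∑ (g i)))

∑₂-*ˡ : (c : ℕ) (f : Fin n → Fin n → ℕ) → ∑₂ (λ i j → c * f i j) ≡ c * ∑₂ f
∑₂-*ˡ c f = sym (trans (*-distribˡ-sum c (λ i → ∑ (f i))) (sum-cong-≗ (λ i → *-distribˡ-sum c (f i))))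

∑₂-separable : (f g : Fin n → ℕ) → ∑₂ (λ i j → f i * g j) ≡ ∑ f * ∑ g
∑₂-separable f g = sym (trans (*-distribʳ-sum (∑ g) f) (sum-cong-≗ (λ i → *-distribˡ-sum (f i) g)))

∑₂-𝟙≢ : ∑₂ {suc n} 𝟙≢ ≡ suc n * n
∑₂-𝟙≢ {n} = trans (sum-cong-≗ row) (∑-const (suc n) n)
  where
  row : (i : Fin (suc n)) → ∑ (𝟙≢ i) ≡ n
  row i = trans (sum-cong-≗ {y = λ j → 𝟙≢ j i} (𝟙≢-sym i)) (∑-𝟙≢ i)

∑-without₂ : (g : Fin n → ℕ) (x y : Fin n) → x ≢ y →
             ∑ (λ v → 𝟙≢ x v * 𝟙≢ y v * g v) + g x + g y ≡ ∑ g
∑-without₂ g x y x≢y = begin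
  ∑ (λ v → 𝟙≢ x v * 𝟙≢ y v * g v) + g x + g y    ≡⟨ +-assoc _ (g x) (g y) ⟩
  ∑ (λ v → 𝟙≢ x v * 𝟙≢ y v * g v) + (g x + g y)  ≡⟨ +-comm _ (g x + g y) ⟩
  g x + g y + ∑ (λ v → 𝟙≢ x v * 𝟙≢ y v * g v)    ≡⟨ cong (g x + g y +_) (sum-cong-≗ reorder) ⟩
  g x + g y + ∑ (λ v → g v * 𝟙≢ v x * 𝟙≢ v y)    ≡⟨ ∑-split-at₂ g x y x≢y ⟨
  ∑ g                                            ∎
  where
  open ≡-Reasoning
  reorder : ∀ v → 𝟙≢ x v * 𝟙≢ y v * g v ≡ g v * 𝟙≢ v x * 𝟙≢ v y
  reorder v rewrite 𝟙≢-sym x v | 𝟙≢-sym y v = solve 3 (λ a b c → a :* b :* c := c :* a :* b) refl (𝟙≢ v x) (𝟙≢ v y) (g v)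

∑-𝟙≢₂ : (x y : Fin (2 + n)) → x ≢ y → ∑ (λ v → 𝟙≢ x v * 𝟙≢ y v) ≡ n
∑-𝟙≢₂ {n} x y x≢y = +-cancelʳ-≡ 2 _ n (begin
  ∑ (λ v → 𝟙≢ x v * 𝟙≢ y v) + 2                 ≡⟨ cong (_+ 2) (sum-cong-≗ (λ v → sym (*-identityʳ (𝟙≢ x v * 𝟙≢ y v)))) ⟩
  ∑ (λ v → 𝟙≢ x v * 𝟙≢ y v * 1) + 2             ≡⟨ +-assoc _ 1 1 ⟨
  ∑ (λ v → 𝟙≢ x v * 𝟙≢ y v * 1) + 1 + 1         ≡⟨ ∑-without₂ (λ _ → 1) x y x≢y ⟩
  ∑ {2 + n} (λ _ → 1)                           ≡⟨ ∑-const (2 + n) 1 ⟩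
  (2 + n) * 1                                   ≡⟨ *-identityʳ (2 + n) ⟩
  2 + n                                         ≡⟨ +-comm 2 n ⟩
  n + 2                                         ∎)
  where open ≡-Reasoning

∑≢ : (Fin n → Fin n → ℕ) → ℕ
∑≢ f = ∑₂ (λ i j → 𝟙≢ i j * f i j)

𝟙≢-cong₁ : {f g : Fin n → ℕ} (i : Fin n) → (∀ j → i ≢ j → f j ≡ g j) → ∀ j → 𝟙≢ i j * f j ≡ 𝟙≢ i j * g j
𝟙≢-cong₁ i f≡g j with i ≟ j
... | yes refl = refl
... | no  i≢j  = cong (1 *_) (f≡g j i≢j)

𝟙≢-cong : {f g : Fin n → Fin n → ℕ} → (∀ i j → i ≢ j → f i j ≡ g i j) →
          ∀ i j → 𝟙≢ i j * f i j ≡ 𝟙≢ i j * g i j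
𝟙≢-cong f≡g i = 𝟙≢-cong₁ i (f≡g i)

∑≢-pos : (f : Fin n → Fin n → ℕ) → 1 ≤ ∑≢ f → ∃[ i ] ∃[ j ] (i ≢ j × 1 ≤ f i j)
∑≢-pos f ∑≥1 =
  let (i , row≥1) = ∑-pos (λ i → ∑ (λ j → 𝟙≢ i j * f i j)) ∑≥1
      (j , term≥1) = ∑-pos (λ j → 𝟙≢ i j * f i j) row≥1
      (i≢j , f≥1) = *-pos⇒pos (𝟙≢ i j) (f i j) term≥1
  in i , j , 𝟙-pos (¬? (i ≟ j)) i≢j , f≥1

∑≢-cong : {f g : Fin n → Fin n → ℕ} → (∀ i j → i ≢ j → f i j ≡ g i j) → ∑≢ f ≡ ∑≢ g
∑≢-cong f≡g = ∑₂-cong (𝟙≢-cong f≡g)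

∑≢-mono : {f g : Fin n → Fin n → ℕ} → (∀ i j → i ≢ j → f i j ≤ g i j) → ∑≢ f ≤ ∑≢ g
∑≢-mono {f = f} {g} f≤g = ∑₂-mono pointwise
  where
  pointwise : ∀ i j → 𝟙≢ i j * f i j ≤ 𝟙≢ i j * g i j
  pointwise i j with i ≟ j
  ... | yes refl = z≤n
  ... | no  i≢j  = *-monoʳ-≤ 1 (f≤g i j i≢j)

∑≢-distrib-+ : (f g : Fin n → Fin n → ℕ) → ∑≢ (λ i j → f i j + g i j) ≡ ∑≢ f + ∑≢ g
∑≢-distrib-+ f g = trans (∑₂-cong (λ i j → *-distribˡ-+ (𝟙≢ i j) (f i j) (g i j)))
                         (∑₂-distrib-+ (λ i j → 𝟙≢ i j * f i j) (λ i j → 𝟙≢ i j * g i j))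

∑≢-*ˡ : (c : ℕ) (f : Fin n → Fin n → ℕ) → ∑≢ (λ i j → c * f i j) ≡ c * ∑≢ f
∑≢-*ˡ c f = trans (∑₂-cong (λ i j → x*[y*z]≡y*[x*z] (𝟙≢ i j) c (f i j))) (∑₂-*ˡ c (λ i j → 𝟙≢ i j * f i j))
  where
  x*[y*z]≡y*[x*z] : ∀ x y z → x * (y * z) ≡ y * (x * z)
  x*[y*z]≡y*[x*z] = solve 3 (λ x y z → x :* (y :* z) := y :* (x :* z)) refl

∑≢-const : (c : ℕ) → ∑≢ {suc n} (λ _ _ → c) ≡ c * (suc n * n)
∑≢-const {n} c = begin
  ∑≢ {suc n} (λ _ _ → c)          ≡⟨ ∑₂-cong {n = suc n} {f = λ i j → 𝟙≢ i j * c} {g = λ i j → c * 𝟙≢ i j} (λ i j → *-comm (𝟙≢ i j) c) ⟩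
  ∑₂ {suc n} (λ i j → c * 𝟙≢ i j) ≡⟨ ∑₂-*ˡ {n = suc n} c 𝟙≢ ⟩
  c * ∑₂ {suc n} 𝟙≢       ≡⟨ cong (c *_) (∑₂-𝟙≢ {n}) ⟩
  c * (suc n * n)         ∎
  where open ≡-Reasoning

∑₂≡∑≢+diag : (f : Fin n → Fin n → ℕ) → ∑₂ f ≡ ∑≢ f + ∑ (λ i → f i i)
∑₂≡∑≢+diag {n} f = begin
  ∑ (λ i → ∑ (f i))                                   ≡⟨ sum-cong-≗ (λ i → ∑-split-at (f i) i) ⟩
  ∑ (λ i → f i i + ∑ (λ j → f i j * 𝟙≢ j i))          ≡⟨ ∑-distrib-+ (λ i → f i i) (λ i → ∑ (λ j → f i j * 𝟙≢ j i)) ⟩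
  ∑ (λ i → f i i) + ∑₂ (λ i j → f i j * 𝟙≢ j i)       ≡⟨ +-comm (∑ (λ i → f i i)) _ ⟩
  ∑₂ (λ i j → f i j * 𝟙≢ j i) + ∑ (λ i → f i i)       ≡⟨ cong (_+ ∑ (λ i → f i i)) (∑₂-cong {n = n} reorder) ⟩
  ∑≢ f + ∑ (λ i → f i i)                              ∎
  where
  open ≡-Reasoning
  reorder : ∀ i j → f i j * 𝟙≢ j i ≡ 𝟙≢ i j * f i j
  reorder i j = trans (*-comm (f i j) (𝟙≢ j i)) (cong (_* f i j) (𝟙≢-sym j i))

∑≢-separable : (g h : Fin n → ℕ) → (∀ i → g i * h i ≡ 0) → ∑≢ (λ i j → g i * h j) ≡ ∑ g * ∑ h
∑≢-separable {n} g h disjoint = begin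
  ∑≢ (λ i j → g i * h j)                                ≡⟨ +-identityʳ _ ⟨
  ∑≢ (λ i j → g i * h j) + 0                            ≡⟨ cong (∑≢ (λ i j → g i * h j) +_) (trans (sum-cong-≗ disjoint) (∑-zero n)) ⟨
  ∑≢ (λ i j → g i * h j) + ∑ (λ i → g i * h i)          ≡⟨ ∑₂≡∑≢+diag (λ i j → g i * h j) ⟨
  ∑₂ (λ i j → g i * h j)                                ≡⟨ ∑₂-separable g h ⟩
  ∑ g * ∑ h                                             ∎
  where open ≡-Reasoning

∑≢-row : (f : Fin n → Fin n → ℕ) (x : Fin n) → ∑≢ (λ i j → 𝟙 (i ≟ x) * f i j) ≡ ∑ (λ j → 𝟙≢ x j * f x j)
∑≢-row {n} f x = begin
  ∑ (λ i → ∑ (λ j → 𝟙≢ i j * (𝟙 (i ≟ x) * f i j)))    ≡⟨ sum-cong-≗ row ⟨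
  ∑ (λ i → ∑ (λ j → 𝟙≢ i j * f i j) * 𝟙 (i ≟ x))      ≡⟨ ∑-pick (λ i → ∑ (λ j → 𝟙≢ i j * f i j)) x ⟩
  ∑ (λ j → 𝟙≢ x j * f x j)                            ∎
  where
  open ≡-Reasoning
  reorder : ∀ i j → 𝟙≢ i j * f i j * 𝟙 (i ≟ x) ≡ 𝟙≢ i j * (𝟙 (i ≟ x) * f i j)
  reorder i j = solve 3 (λ a b c → a :* b :* c := a :* (c :* b)) refl (𝟙≢ i j) (f i j) (𝟙 (i ≟ x))
  row : ∀ i → ∑ (λ j → 𝟙≢ i j * f i j) * 𝟙 (i ≟ x) ≡ ∑ (λ j → 𝟙≢ i j * (𝟙 (i ≟ x) * f i j))
  row i = trans (*-distribʳ-sum (𝟙 (i ≟ x)) (λ j → 𝟙≢ i j * f i j)) (sum-cong-≗ (reorder i))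

∑-∑≢-comm : (f : Fin n → Fin n → Fin n → ℕ) →
            ∑ (λ v → ∑≢ (f v)) ≡ ∑≢ (λ i j → ∑ (λ v → f v i j))
∑-∑≢-comm {n} f = begin
  ∑ (λ v → ∑ (λ i → ∑ (λ j → 𝟙≢ i j * f v i j)))   ≡⟨ ∑-comm (λ v i → ∑ (λ j → 𝟙≢ i j * f v i j)) ⟩
  ∑ (λ i → ∑ (λ v → ∑ (λ j → 𝟙≢ i j * f v i j)))   ≡⟨ sum-cong-≗ (λ i → ∑-comm (λ v j → 𝟙≢ i j * f v i j)) ⟩
  ∑₂ (λ i j → ∑ (λ v → 𝟙≢ i j * f v i j))          ≡⟨ ∑₂-cong {n = n} (λ i j → *-distribˡ-sum (𝟙≢ i j) (λ v → f v i j)) ⟨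
  ∑≢ (λ i j → ∑ (λ v → f v i j))                   ∎
  where open ≡-Reasoning

χ : Subset n → Fin n → ℕ
χ p i = 𝟙 (i ∈? p)

χ≤1 : (p : Subset n) (i : Fin n) → χ p i ≤ 1
χ≤1 p i = 𝟙≤1 (i ∈? p)

χ-∈ : {p : Subset n} {i : Fin n} → i ∈ p → χ p i ≡ 1
χ-∈ {p = p} {i} = 𝟙-yes (i ∈? p)

χ-∉ : {p : Subset n} {i : Fin n} → i ∉ p → χ p i ≡ 0
χ-∉ {p = p} {i} = 𝟙-no (i ∈? p)

χ*-∈ : {p : Subset n} {i : Fin n} (t : ℕ) → i ∈ p → χ p i * t ≡ t
χ*-∈ t i∈p = trans (cong (_* t) (χ-∈ i∈p)) (+-identityʳ t)

χ*-∉ : {p : Subset n} {i : Fin n} (t : ℕ) → i ∉ p → χ p i * t ≡ 0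
χ*-∉ t i∉p = cong (_* t) (χ-∉ i∉p)

𝟙-map′ : (f : P → Q) (g : Q → P) (d : Dec P) → 𝟙 (Dec.map′ f g d) ≡ 𝟙 d
𝟙-map′ f g (yes _) = refl
𝟙-map′ f g (no _)  = refl

∣p∣≡∑χ : (p : Subset n) → ∣ p ∣ ≡ ∑ (χ p)
∣p∣≡∑χ []            = refl
∣p∣≡∑χ (inside ∷ p)  = cong suc (trans (∣p∣≡∑χ p) (sum-cong-≗ (λ i → sym (𝟙-map′ _ _ (i ∈? p)))))
∣p∣≡∑χ (outside ∷ p) = trans (∣p∣≡∑χ p) (sum-cong-≗ (λ i → sym (𝟙-map′ _ _ (i ∈? p))))

∑χ : {k : ℕ} (p : Subset n) → ∣ p ∣ ≡ k → ∑ (χ p) ≡ k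
∑χ p ∣p∣≡k = trans (sym (∣p∣≡∑χ p)) ∣p∣≡k

⊆∧∣≡∣⇒⊇ : {p q : Subset n} → p ⊆ q → ∣ p ∣ ≡ ∣ q ∣ → q ⊆ p
⊆∧∣≡∣⇒⊇ {p = p} p⊆q ∣p∣≡∣q∣ {x} x∈q with x ∈? p
... | yes x∈p = x∈p
... | no  x∉p = contradiction ∣p∣≡∣q∣ (<⇒≢ (p⊂q⇒∣p∣<∣q∣ (p⊆q , x , x∈q , x∉p)))

∃∈∖ : {e Y : Subset n} {x : Fin n} → ∣ Y ∣ ≡ ∣ e ∣ → x ∈ e → x ∉ Y → ∃[ y ] (y ∈ Y × y ∉ e)
∃∈∖ {e = e} {Y} {x} ∣Y∣≡∣e∣ x∈e x∉Y with Fin.any? (λ y → (y ∈? Y) ×-dec ¬? (y ∈? e))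
... | yes found = found
... | no  none  = contradiction (⊆∧∣≡∣⇒⊇ Y⊆e ∣Y∣≡∣e∣ x∈e) x∉Y
  where
  Y⊆e : Y ⊆ e
  Y⊆e {y} y∈Y with y ∈? e
  ... | yes y∈e = y∈e
  ... | no  y∉e = contradiction (y , y∈Y , y∉e) none

∑χ∩≤ : {k : ℕ} (e f : Subset n) → ∣ e ∣ ≡ suc k → ∣ f ∣ ≡ suc k → e ≢ f →
       ∑ (λ i → χ e i * χ f i) ≤ k
∑χ∩≤ {k = k} e f ∣e∣ ∣f∣ e≢f with ∑ (λ i → χ e i * χ f i) ≤? k
... | yes ≤k = ≤k
... | no  ≰k = contradiction (⊆-antisym e⊆f (⊆∧∣≡∣⇒⊇ e⊆f (trans ∣e∣ (sym ∣f∣)))) e≢f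
  where
  χ∩≤χe : ∀ i → χ e i * χ f i ≤ χ e i
  χ∩≤χe i = ≤-trans (*-monoʳ-≤ (χ e i) (χ≤1 f i)) (≤-reflexive (*-identityʳ (χ e i)))
  χe≤χ∩ : ∀ i → χ e i ≤ χ e i * χ f i
  χe≤χ∩ = ∑-mono-tight (λ i → χ e i * χ f i) (χ e) χ∩≤χe
          (subst (_≤ ∑ (λ i → χ e i * χ f i)) (sym (∑χ e ∣e∣)) (≰⇒> ≰k))
  e⊆f : e ⊆ f
  e⊆f {i} i∈e with i ∈? f
  ... | yes i∈f = i∈f
  ... | no  i∉f = contradiction (subst₂ _≤_ (χ-∈ i∈e) (cong (χ e i *_) (χ-∉ i∉f)) (χe≤χ∩ i))
                                (λ 1≤χ0 → 1+n≰n (≤-trans 1≤χ0 (≤-reflexive (*-zeroʳ (χ e i)))))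

∃∈? : {P : T → Set} → (∀ x → Dec (P x)) → (xs : List T) → Dec (∃[ x ] (x ∈ˡ xs × P x))
∃∈? P? xs = Dec.map′ Membership.find (λ (x , x∈ , p) → Membership.lose x∈ p) (any? P? xs)

sum-map-cong : (xs : List T) {f g : T → ℕ} → (∀ x → x ∈ˡ xs → f x ≡ g x) → sum (map f xs) ≡ sum (map g xs)
sum-map-cong []       f≡g = refl
sum-map-cong (x ∷ xs) f≡g = cong₂ _+_ (f≡g x (here refl)) (sum-map-cong xs (λ y y∈ → f≡g y (there y∈)))

sum-map-mono : (xs : List T) {f g : T → ℕ} → (∀ x → x ∈ˡ xs → f x ≤ g x) → sum (map f xs) ≤ sum (map g xs)
sum-map-mono []       f≤g = z≤n
sum-map-mono (x ∷ xs) f≤g = +-mono-≤ (f≤g x (here refl)) (sum-map-mono xs (λ y y∈ → f≤g y (there y∈)))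

sum-map-zero : (xs : List T) → sum (map (λ _ → 0) xs) ≡ 0
sum-map-zero []       = refl
sum-map-zero (x ∷ xs) = sum-map-zero xs

*-distribˡ-sum-map : (a : ℕ) (f : T → ℕ) (xs : List T) → a * sum (map f xs) ≡ sum (map (λ x → a * f x) xs)
*-distribˡ-sum-map a f []       = *-zeroʳ a
*-distribˡ-sum-map a f (x ∷ xs) = trans (*-distribˡ-+ a (f x) _) (cong (a * f x +_) (*-distribˡ-sum-map a f xs))

sum-map-tabulate : (k : Fin n → T) (f : T → ℕ) → sum (map f (tabulate k)) ≡ ∑ (λ i → f (k i))
sum-map-tabulate {n = zero}  k f = refl
sum-map-tabulate {n = suc n} k f = cong (f (k zero) +_) (sum-map-tabulate (k ∘ suc) f)

sum-map-filter : {P : Pred T _} (P? : Decidable P) (xs : List T) (f : T → ℕ) →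
                 sum (map f (filter P? xs)) ≡ sum (map (λ y → 𝟙 (P? y) * f y) xs)
sum-map-filter P? []       f = refl
sum-map-filter P? (x ∷ xs) f with P? x
... | yes _ = cong₂ _+_ (sym (+-identityʳ (f x))) (sum-map-filter P? xs f)
... | no  _ = sum-map-filter P? xs f

sum-∑-comm : (xs : List T) (f : T → Fin n → ℕ) →
             sum (map (λ x → ∑ (f x)) xs) ≡ ∑ (λ j → sum (map (λ x → f x j) xs))
sum-∑-comm {n = n} []   f = sym (∑-zero n)
sum-∑-comm (x ∷ xs) f =
  trans (cong (∑ (f x) +_) (sum-∑-comm xs f)) (sym (∑-distrib-+ (f x) (λ j → sum (map (λ y → f y j) xs))))

module _ {P : T → Set} (P? : ∀ a → Dec (P a)) where

  count : List T → ℕ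
  count xs = sum (map (λ x → 𝟙 (P? x)) xs)

  ∈⇒count-pos : ∀ {xs x} → x ∈ˡ xs → P x → 1 ≤ count xs
  ∈⇒count-pos {x ∷ xs} (here refl) p rewrite 𝟙-yes (P? x) p = s≤s z≤n
  ∈⇒count-pos {y ∷ xs} (there x∈) p = ≤-trans (∈⇒count-pos x∈ p) (m≤n+m _ (𝟙 (P? y)))

  count-pos⇒∈ : ∀ xs → 1 ≤ count xs → ∃[ x ] (x ∈ˡ xs × P x)
  count-pos⇒∈ (x ∷ xs) h with P? x
  ... | yes p = x , here refl , p
  ... | no  _ with count-pos⇒∈ xs h
  ...   | y , y∈ , p = y , there y∈ , p

  two∈⇒count≥2 : ∀ {xs x y} → x ∈ˡ xs → y ∈ˡ xs → x ≢ y → P x → P y → 2 ≤ count xs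
  two∈⇒count≥2 (here refl) (here refl) x≢y _ _ = contradiction refl x≢y
  two∈⇒count≥2 {x ∷ _} (here refl) (there y∈) _ px py rewrite 𝟙-yes (P? x) px = s≤s (∈⇒count-pos y∈ py)
  two∈⇒count≥2 {y ∷ _} (there x∈) (here refl) _ px py rewrite 𝟙-yes (P? y) py = s≤s (∈⇒count-pos x∈ px)
  two∈⇒count≥2 {z ∷ _} (there x∈) (there y∈) x≢y px py =
    ≤-trans (two∈⇒count≥2 x∈ y∈ x≢y px py) (m≤n+m _ (𝟙 (P? z)))

  count≥2⇒two∈ : ∀ xs → Unique xs → 2 ≤ count xs →
                 ∃[ x ] ∃[ y ] (x ∈ˡ xs × y ∈ˡ xs × x ≢ y × P x × P y)
  count≥2⇒two∈ (x ∷ xs) (x∉xs ∷ u) h with P? x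
  ... | yes px with count-pos⇒∈ xs (≤-pred h)
  ...   | y , y∈ , py = x , y , here refl , there y∈ , All.lookup x∉xs y∈ , px , py
  count≥2⇒two∈ (x ∷ xs) (_ ∷ u) h | no _ with count≥2⇒two∈ xs u h
  ...   | y , z , y∈ , z∈ , y≢z , py , pz = y , z , there y∈ , there z∈ , y≢z , py , pz

pairSum-mono : (xs : List T) {f g : T → T → ℕ} → Unique xs →
               (∀ x y → x ∈ˡ xs → y ∈ˡ xs → x ≢ y → f x y ≤ g x y) → pairSum f xs ≤ pairSum g xs
pairSum-mono []       _            _   = z≤n
pairSum-mono (x ∷ xs) (x∉xs ∷ u) f≤g =
  +-mono-≤ (sum-map-mono xs (λ y y∈ → f≤g x y (here refl) (there y∈) (All.lookup x∉xs y∈)))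
           (pairSum-mono xs u (λ a b a∈ b∈ → f≤g a b (there a∈) (there b∈)))

pairSum-cong : (xs : List T) {f g : T → T → ℕ} → Unique xs →
               (∀ x y → x ∈ˡ xs → y ∈ˡ xs → x ≢ y → f x y ≡ g x y) → pairSum f xs ≡ pairSum g xs
pairSum-cong xs u f≡g = ≤-antisym (pairSum-mono xs u (λ a b a∈ b∈ a≢b → ≤-reflexive (f≡g a b a∈ b∈ a≢b)))
                                  (pairSum-mono xs u (λ a b a∈ b∈ a≢b → ≤-reflexive (sym (f≡g a b a∈ b∈ a≢b))))

pairSum-filter : {P : Pred T _} (P? : Decidable P) (xs : List T) (g : T → T → ℕ) →
                 pairSum g (filter P? xs) ≡ pairSum (λ x y → 𝟙 (P? x) * 𝟙 (P? y) * g x y) xs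
pairSum-filter P? []       g = refl
pairSum-filter P? (x ∷ xs) g with P? x
... | yes _ = cong₂ _+_ (trans (sum-map-filter P? xs (g x))
                               (sum-map-cong xs (λ y _ → cong (_* g x y) (sym (+-identityʳ (𝟙 (P? y)))))))
                        (pairSum-filter P? xs g)
... | no  _ = trans (pairSum-filter P? xs g)
                    (cong (_+ pairSum (λ x y → 𝟙 (P? x) * 𝟙 (P? y) * g x y) xs) (sym (sum-map-zero xs)))

𝟙≢-suc : (i j : Fin n) → 𝟙≢ (suc i) (suc j) ≡ 𝟙≢ i j
𝟙≢-suc i j = 𝟙-cong (¬? (suc i ≟ suc j)) (¬? (i ≟ j)) (λ h → h ∘ cong suc) (λ h → h ∘ Fin.suc-injective)

pairSum-tabulate : (k : Fin n → T) (g : T → T → ℕ) → (∀ a b → g a b ≡ g b a) →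
                   2 * pairSum g (tabulate k) ≡ ∑≢ (λ i j → g (k i) (k j))
pairSum-tabulate {n = zero}  k g g-sym = refl
pairSum-tabulate {n = suc n} {T = T} k g g-sym = begin
  2 * (sum (map (g (k zero)) (tabulate k′)) + pairSum g (tabulate k′))
    ≡⟨ *-distribˡ-+ 2 (sum (map (g (k zero)) (tabulate k′))) (pairSum g (tabulate k′)) ⟩
  2 * sum (map (g (k zero)) (tabulate k′)) + 2 * pairSum g (tabulate k′)
    ≡⟨ cong₂ _+_ (cong (2 *_) (sum-map-tabulate k′ (g (k zero)))) (pairSum-tabulate k′ g g-sym) ⟩
  2 * row₀ + rest
    ≡⟨ cong (_+ rest) (cong (row₀ +_) (trans (+-identityʳ row₀) (sum-cong-≗ (λ i → g-sym (k zero) (k′ i))))) ⟩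
  (row₀ + col₀) + rest
    ≡⟨ +-assoc row₀ col₀ rest ⟩
  row₀ + (col₀ + rest)
    ≡⟨ cong₂ _+_ (sum-cong-≗ (λ i → sym (+-identityʳ (g (k zero) (k′ i)))))
                 (cong₂ _+_ (sum-cong-≗ (λ i → sym (+-identityʳ (g (k′ i) (k zero)))))
                            (∑₂-cong (λ i j → cong (_* g (k′ i) (k′ j)) (sym (𝟙≢-suc i j))))) ⟩
  ∑ (λ j → 𝟙≢ zero (suc j) * g (k zero) (k′ j)) + (col₀′ + rest′)
    ≡⟨ cong (∑ (λ j → 𝟙≢ zero (suc j) * g (k zero) (k′ j)) +_) (sym (∑-distrib-+ (λ i → 𝟙≢ (suc i) zero * g (k′ i) (k zero))
                                   (λ i → ∑ (λ j → 𝟙≢ (suc i) (suc j) * g (k′ i) (k′ j))))) ⟩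
  ∑≢ (λ i j → g (k i) (k j))
    ∎
  where
  open ≡-Reasoning
  k′ : Fin n → T
  k′ = k ∘ suc
  row₀ col₀ rest col₀′ rest′ : ℕ
  row₀ = ∑ (λ i → g (k zero) (k′ i))
  col₀ = ∑ (λ i → g (k′ i) (k zero))
  rest = ∑₂ (λ i j → 𝟙≢ i j * g (k′ i) (k′ j))
  col₀′ = ∑ (λ i → 𝟙≢ (suc i) zero * g (k′ i) (k zero))
  rest′ = ∑₂ (λ i j → 𝟙≢ (suc i) (suc j) * g (k′ i) (k′ j))


avoid-two : (a b : Fin (3 + n)) → ∃[ y ] (y ≢ a × y ≢ b)
avoid-two zero          zero          = suc zero       , (λ ()) , (λ ())
avoid-two zero          (suc zero)    = suc (suc zero) , (λ ()) , (λ ())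
avoid-two zero          (suc (suc _)) = suc zero       , (λ ()) , (λ ())
avoid-two (suc zero)    zero          = suc (suc zero) , (λ ()) , (λ ())
avoid-two (suc zero)    (suc _)       = zero           , (λ ()) , (λ ())
avoid-two (suc (suc _)) zero          = suc zero       , (λ ()) , (λ ())
avoid-two (suc (suc _)) (suc _)       = zero           , (λ ()) , (λ ())

pairSum-allFin : (g : Fin n → Fin n → ℕ) → (∀ a b → g a b ≡ g b a) → 2 * pairSum g (allFin n) ≡ ∑≢ g
pairSum-allFin g g-sym = pairSum-tabulate (λ i → i) g g-sym

pairSum-otherVertices : (v : Fin n) (g : Fin n → Fin n → ℕ) → (∀ a b → g a b ≡ g b a) →
                        2 * pairSum g (otherVertices v) ≡ ∑≢ (λ i j → 𝟙≢ i v * 𝟙≢ j v * g i j)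
pairSum-otherVertices {n} v g g-sym = trans (cong (2 *_) (pairSum-filter (λ u → ¬? (u ≟ v)) (allFin n) g))
  (pairSum-allFin (λ i j → 𝟙≢ i v * 𝟙≢ j v * g i j) (λ a b → cong₂ _*_ (*-comm (𝟙≢ a v) (𝟙≢ b v)) (g-sym a b)))

Adj : Hyperedges n → Fin n → Fin n → Set
Adj F x y = ∃[ e ] (e ∈ˡ F × x ∈ e × y ∈ e)

CommonNbr : Hyperedges n → Fin n → Fin n → Set
CommonNbr F x y = ∃[ z ] (Adj F x z × Adj F z y)

Far : Hyperedges n → Fin n → Fin n → Set
Far F x y = ¬ Adj F x y × ¬ CommonNbr F x y

private variable
  F : Hyperedges n
  x y : Fin n

adj? : (F : Hyperedges n) (x y : Fin n) → Dec (Adj F x y)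
adj? F x y = ∃∈? (λ e → (x ∈? e) ×-dec (y ∈? e)) F

commonNbr? : (F : Hyperedges n) (x y : Fin n) → Dec (CommonNbr F x y)
commonNbr? F x y = Fin.any? (λ z → adj? F x z ×-dec adj? F z y)

far? : (F : Hyperedges n) (x y : Fin n) → Dec (Far F x y)
far? F x y = ¬? (adj? F x y) ×-dec ¬? (commonNbr? F x y)

Adj-sym : Adj F x y → Adj F y x
Adj-sym (e , e∈ , x∈e , y∈e) = e , e∈ , y∈e , x∈e

Far-sym : Far F x y → Far F y x
Far-sym (¬adj , ¬cn) = ¬adj ∘ Adj-sym , λ { (z , xz , zy) → ¬cn (z , Adj-sym zy , Adj-sym xz) }

adj⇒walk₁ : Adj F x y → Walk F x y 1
adj⇒walk₁ (e , e∈ , x∈e , y∈e) = step e e∈ x∈e y∈e here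

_++ʷ_ : ∀ {z k} → Walk F x y k → Walk F y z ℓ → Walk F x z (k + ℓ)
here                   ++ʷ w′ = w′
step e e∈ x∈e y∈e w ++ʷ w′ = step e e∈ x∈e y∈e (w ++ʷ w′)

commonNbr⇒walk₂ : CommonNbr F x y → Walk F x y 2
commonNbr⇒walk₂ (z , xz , zy) = adj⇒walk₁ xz ++ʷ adj⇒walk₁ zy

walk₀⇒≡ : Walk F x y 0 → x ≡ y
walk₀⇒≡ here = refl

walk₁⇒adj : Walk F x y 1 → Adj F x y
walk₁⇒adj (step e e∈ x∈e y∈e here) = e , e∈ , x∈e , y∈e

walk₂⇒commonNbr : Walk F x y 2 → CommonNbr F x y
walk₂⇒commonNbr (step {x = z} e e∈ x∈e z∈e w) = z , (e , e∈ , x∈e , z∈e) , walk₁⇒adj w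

walk≥1 : Walk F x y ℓ → x ≢ y → 1 ≤ ℓ
walk≥1 {ℓ = zero}  w x≢y = contradiction (walk₀⇒≡ w) x≢y
walk≥1 {ℓ = suc ℓ} _ _   = s≤s z≤n

walk≥2 : Walk F x y ℓ → x ≢ y → ¬ Adj F x y → 2 ≤ ℓ
walk≥2 {ℓ = zero}        w x≢y _    = contradiction (walk₀⇒≡ w) x≢y
walk≥2 {ℓ = suc zero}    w _   ¬adj = contradiction (walk₁⇒adj w) ¬adj
walk≥2 {ℓ = suc (suc ℓ)} _ _   _    = s≤s (s≤s z≤n)

walk≥3 : Walk F x y ℓ → x ≢ y → Far F x y → 3 ≤ ℓ
walk≥3 {ℓ = zero}              w x≢y _          = contradiction (walk₀⇒≡ w) x≢y
walk≥3 {ℓ = suc zero}          w _   (¬adj , _) = contradiction (walk₁⇒adj w) ¬adj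
walk≥3 {ℓ = suc (suc zero)}    w _   (_ , ¬cn)  = contradiction (walk₂⇒commonNbr w) ¬cn
walk≥3 {ℓ = suc (suc (suc ℓ))} _ _   _          = s≤s (s≤s (s≤s z≤n))

walk-leaves : (S : Subset n) → Walk F x y ℓ → x ∈ S → y ∉ S →
              ∃[ e ] ∃[ p ] ∃[ q ] (e ∈ˡ F × p ∈ e × q ∈ e × p ∈ S × q ∉ S)
walk-leaves S here x∈S y∉S = contradiction x∈S y∉S
walk-leaves S (step {x = x′} e e∈ x∈e x′∈e w) x∈S y∉S with x′ ∈? S
... | yes x′∈S = walk-leaves S w x′∈S y∉S
... | no  x′∉S = e , _ , x′ , e∈ , x∈e , x′∈e , x∈S , x′∉S

walk-first-edge : Walk F x y ℓ → x ≢ y → ∃[ e ] (e ∈ˡ F × x ∈ e)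
walk-first-edge here               x≢y = contradiction refl x≢y
walk-first-edge (step e e∈ x∈e _ _) _  = e , e∈ , x∈e

∈-deleteEdges⁺ : ∀ {v e} {E : Hyperedges n} → e ∈ˡ E → v ∉ e → e ∈ˡ deleteEdges v E
∈-deleteEdges⁺ {v = v} = ∈-filter⁺ (λ e → ¬? (v ∈? e))

∈-deleteEdges⁻ : ∀ {v e} {E : Hyperedges n} → e ∈ˡ deleteEdges v E → e ∈ˡ E × v ∉ e
∈-deleteEdges⁻ {v = v} = ∈-filter⁻ (λ e → ¬? (v ∈? e))

∈-otherVertices⁺ : ∀ {v u : Fin n} → u ≢ v → u ∈ˡ otherVertices v
∈-otherVertices⁺ {v = v} {u} = ∈-filter⁺ (λ u → ¬? (u ≟ v)) (∈-allFin u)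

∈-otherVertices⁻ : ∀ {v u : Fin n} → u ∈ˡ otherVertices v → u ≢ v
∈-otherVertices⁻ {n = n} {v = v} u∈ = proj₂ (∈-filter⁻ (λ u → ¬? (u ≟ v)) {xs = allFin n} u∈)

-- The hypergraph after deleting a vertex

module VertexDeletions (E : Hyperedges 9) (E-unique : Unique E) (E-uniform : Uniform E 4)
         (E∖-connected : ∀ v x y → x ≢ v → y ≢ v → ∃[ ℓ ] Walk (deleteEdges v E) x y ℓ) where

  E∖ : Fin 9 → Hyperedges 9
  E∖ v = deleteEdges v E

  ∈E∖⁺ : ∀ {v e} → e ∈ˡ E → v ∉ e → e ∈ˡ E∖ v
  ∈E∖⁺ = ∈-deleteEdges⁺

  ∈E∖⁻ : ∀ {v e} → e ∈ˡ E∖ v → e ∈ˡ E × v ∉ e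
  ∈E∖⁻ = ∈-deleteEdges⁻ {E = E}

  edge-size : ∀ {e} → e ∈ˡ E → ∣ e ∣ ≡ 4
  edge-size = All.lookup E-uniform

  edge-avoiding : ∀ v x → x ≢ v → ∃[ e ] (e ∈ˡ E × v ∉ e × x ∈ e)
  edge-avoiding v x x≢v with avoid-two x v
  ... | y , y≢x , y≢v with E∖-connected v x y x≢v y≢v
  ... | _ , w with walk-first-edge w (y≢x ∘ sym)
  ... | e , e∈E∖ , x∈e = e , proj₁ (∈E∖⁻ e∈E∖) , proj₂ (∈E∖⁻ e∈E∖) , x∈e

  disjoint-edges-cover : ∀ {A B : Subset 9} {v z} → ∣ A ∣ ≡ 4 → ∣ B ∣ ≡ 4 → (∀ z → z ∈ A → z ∉ B) →
                         v ∉ A → v ∉ B → z ≢ v → z ∉ A → z ∈ B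
  disjoint-edges-cover {A} {B} {v} {z} ∣A∣ ∣B∣ A∩B=∅ v∉A v∉B z≢v z∉A with z ∈? B
  ... | yes z∈B = z∈B
  ... | no  z∉B = contradiction (≤-trans (≤-reflexive (sym ∑f≡10)) ∑f≤9) 1+n≰n
    where
    f : Fin 9 → ℕ
    f i = χ A i + χ B i + 𝟙 (i ≟ v) + 𝟙 (i ≟ z)
    ∑f≡10 : ∑ f ≡ 10
    ∑f≡10 = begin
      ∑ f                                                         ≡⟨ ∑-distrib-+ (λ i → χ A i + χ B i + 𝟙 (i ≟ v)) (λ i → 𝟙 (i ≟ z)) ⟩
      ∑ (λ i → χ A i + χ B i + 𝟙 (i ≟ v)) + ∑ (λ i → 𝟙 (i ≟ z))  ≡⟨ cong (_+ ∑ (λ i → 𝟙 (i ≟ z))) (∑-distrib-+ (λ i → χ A i + χ B i) (λ i → 𝟙 (i ≟ v))) ⟩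
      ∑ (λ i → χ A i + χ B i) + ∑ (λ i → 𝟙 (i ≟ v)) + ∑ (λ i → 𝟙 (i ≟ z))
        ≡⟨ cong (λ a → a + ∑ (λ i → 𝟙 (i ≟ v)) + ∑ (λ i → 𝟙 (i ≟ z))) (∑-distrib-+ (χ A) (χ B)) ⟩
      ∑ (χ A) + ∑ (χ B) + ∑ (λ i → 𝟙 (i ≟ v)) + ∑ (λ i → 𝟙 (i ≟ z))
        ≡⟨ cong₂ (λ a b → a + b + ∑ (λ i → 𝟙 (i ≟ v)) + ∑ (λ i → 𝟙 (i ≟ z))) (∑χ A ∣A∣) (∑χ B ∣B∣) ⟩
      8 + ∑ (λ i → 𝟙 (i ≟ v)) + ∑ (λ i → 𝟙 (i ≟ z))                ≡⟨ cong₂ (λ a b → 8 + a + b) (∑-𝟙≟ v) (∑-𝟙≟ z) ⟩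
      10                                                          ∎
      where open ≡-Reasoning
    f≤1 : ∀ i → f i ≤ 1
    f≤1 i with i ∈? A | i ∈? B | i ≟ v | i ≟ z
    ... | yes i∈A | yes i∈B | _        | _        = contradiction i∈B (A∩B=∅ i i∈A)
    ... | yes i∈A | no  _   | yes refl | _        = contradiction i∈A v∉A
    ... | yes i∈A | no  _   | no  _    | yes refl = contradiction i∈A z∉A
    ... | yes _   | no  _   | no  _    | no  _    = ≤-refl
    ... | no  _   | yes i∈B | yes refl | _        = contradiction i∈B v∉B
    ... | no  _   | yes i∈B | no  _    | yes refl = contradiction i∈B z∉B
    ... | no  _   | yes _   | no  _    | no  _    = ≤-refl
    ... | no  _   | no  _   | yes refl | yes refl = contradiction refl z≢v
    ... | no  _   | no  _   | yes refl | no  _    = ≤-refl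
    ... | no  _   | no  _   | no  _    | yes _    = ≤-refl
    ... | no  _   | no  _   | no  _    | no  _    = z≤n
    ∑f≤9 : ∑ f ≤ 9
    ∑f≤9 = ≤-trans (∑-mono f≤1) (≤-reflexive (∑-const 9 1))

  record Split (v : Fin 9) : Set where
    field
      A B G         : Subset 9
      A∈E           : A ∈ˡ E
      B∈E           : B ∈ˡ E
      G∈E           : G ∈ˡ E
      v∉A           : v ∉ A
      v∉B           : v ∉ B
      v∉G           : v ∉ G
      A∩B=∅         : ∀ z → z ∈ A → z ∉ B
      p q           : Fin 9
      p∈A           : p ∈ A
      p∈G           : p ∈ G
      q∈B           : q ∈ B
      q∈G           : q ∈ G

    ∉A⇒∈B : ∀ z → z ≢ v → z ∉ A → z ∈ B
    ∉A⇒∈B z = disjoint-edges-cover (edge-size A∈E) (edge-size B∈E) A∩B=∅ v∉A v∉B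

  far⇒split : ∀ v x y → x ≢ v → y ≢ v → Far (E∖ v) x y →
              Σ (Split v) (λ sp → x ∈ Split.A sp × y ∈ Split.B sp)
  far⇒split v x y x≢v y≢v (¬adj , ¬cn) with edge-avoiding v x x≢v | edge-avoiding v y y≢v
  ... | A , A∈E , v∉A , x∈A | B , B∈E , v∉B , y∈B with E∖-connected v x y x≢v y≢v
  ... | _ , w with walk-leaves A w x∈A (λ y∈A → ¬adj (A , ∈E∖⁺ A∈E v∉A , x∈A , y∈A))
  ... | G , p , q , G∈E∖ , p∈G , q∈G , p∈A , q∉A =
    record { A = A ; B = B ; G = G ; A∈E = A∈E ; B∈E = B∈E ; G∈E = proj₁ (∈E∖⁻ G∈E∖)
           ; v∉A = v∉A ; v∉B = v∉B ; v∉G = v∉G ; A∩B=∅ = A∩B=∅ ; p = p ; q = q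
           ; p∈A = p∈A ; p∈G = p∈G ; q∈B = q∈B ; q∈G = q∈G } , x∈A , y∈B
    where
    v∉G : v ∉ G
    v∉G = proj₂ (∈E∖⁻ G∈E∖)
    A∩B=∅ : ∀ z → z ∈ A → z ∉ B
    A∩B=∅ z z∈A z∈B = ¬cn (z , (A , ∈E∖⁺ A∈E v∉A , x∈A , z∈A) , (B , ∈E∖⁺ B∈E v∉B , z∈B , y∈B))
    q∈B : q ∈ B
    q∈B = disjoint-edges-cover (edge-size A∈E) (edge-size B∈E) A∩B=∅ v∉A v∉B (λ { refl → v∉G q∈G }) q∉A

  far⇒walk₃ : ∀ v x y → x ≢ v → y ≢ v → Far (E∖ v) x y → Walk (E∖ v) x y 3
  far⇒walk₃ v x y x≢v y≢v far with far⇒split v x y x≢v y≢v far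
  ... | sp , x∈A , y∈B =
    step A (∈E∖⁺ A∈E v∉A) x∈A p∈A (step G (∈E∖⁺ G∈E v∉G) p∈G q∈G
      (step B (∈E∖⁺ B∈E v∉B) q∈B y∈B here))
    where open Split sp

  nonadj∖ far∖ : Fin 9 → Fin 9 → Fin 9 → ℕ
  nonadj∖ v i j = 𝟙 (¬? (adj? (E∖ v) i j))
  far∖ v i j = 𝟙 (far? (E∖ v) i j)

  d∖ : Fin 9 → Fin 9 → Fin 9 → ℕ
  d∖ v x y = 1 + nonadj∖ v x y + far∖ v x y

  dist∖≡d∖ : ∀ v x y {d} → x ≢ v → y ≢ v → x ≢ y → IsDist (E∖ v) x y d → d ≡ d∖ v x y
  dist∖≡d∖ v x y x≢v y≢v x≢y (w , min) with adj? (E∖ v) x y | far? (E∖ v) x y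
  ... | yes adj | yes (¬adj , _) = contradiction adj ¬adj
  ... | yes adj | no  _   = ≤-antisym (min 1 (adj⇒walk₁ adj)) (walk≥1 w x≢y)
  ... | no ¬adj | yes far = ≤-antisym (min 3 (far⇒walk₃ v x y x≢v y≢v far)) (walk≥3 w x≢y far)
  ... | no ¬adj | no ¬far with commonNbr? (E∖ v) x y
  ...   | yes cn  = ≤-antisym (min 2 (commonNbr⇒walk₂ cn)) (walk≥2 w x≢y ¬adj)
  ...   | no  ¬cn = contradiction (¬adj , ¬cn) ¬far

  nonadj : Fin 9 → Fin 9 → ℕ
  nonadj i j = 𝟙 (¬? (adj? E i j))

  d-low : Fin 9 → Fin 9 → ℕ
  d-low x y = 1 + nonadj x y

  d-low≤dist : ∀ x y {d} → x ≢ y → IsDist E x y d → d-low x y ≤ d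
  d-low≤dist x y x≢y (w , _) with adj? E x y
  ... | yes _    = walk≥1 w x≢y
  ... | no  ¬adj = walk≥2 w x≢y ¬adj

  -- Sums over pairs run over ordered pairs: twiceW∖ v is 2·W(H − v), twiceW-low is the lower
  -- bound Σ (1 + [non-adjacent]) for 2·W(H), and Z, C, S, M, X are twice the unordered counts.
  twiceW∖ : Fin 9 → ℕ
  twiceW∖ v = ∑≢ (λ i j → 𝟙≢ i v * 𝟙≢ j v * d∖ v i j)

  twiceW-low : ℕ
  twiceW-low = ∑≢ d-low

  𝟙nonadj-sym : ∀ (F : Hyperedges 9) x y → 𝟙 (¬? (adj? F x y)) ≡ 𝟙 (¬? (adj? F y x))
  𝟙nonadj-sym F x y = 𝟙-cong (¬? (adj? F x y)) (¬? (adj? F y x)) (λ h → h ∘ Adj-sym) (λ h → h ∘ Adj-sym)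

  𝟙far-sym : ∀ (F : Hyperedges 9) x y → 𝟙 (far? F x y) ≡ 𝟙 (far? F y x)
  𝟙far-sym F x y = 𝟙-cong (far? F x y) (far? F y x) Far-sym Far-sym

  d∖-sym : ∀ v x y → d∖ v x y ≡ d∖ v y x
  d∖-sym v x y = cong₂ (λ a b → 1 + a + b) (𝟙nonadj-sym (E∖ v) x y) (𝟙far-sym (E∖ v) x y)

  twiceW∖≡ : ∀ v {W} → WienerIs (E∖ v) (otherVertices v) W → 2 * W ≡ twiceW∖ v
  twiceW∖≡ v {W} (d , isDist , W≡) = begin
    2 * W                                  ≡⟨ cong (2 *_) W≡ ⟩
    2 * pairSum d (otherVertices v)        ≡⟨ cong (2 *_) (pairSum-cong (otherVertices v) unique d≡d∖) ⟩
    2 * pairSum (d∖ v) (otherVertices v)   ≡⟨ pairSum-otherVertices v (d∖ v) (d∖-sym v) ⟩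
    twiceW∖ v                              ∎
    where
    open ≡-Reasoning
    unique : Unique (otherVertices v)
    unique = Unique.filter⁺ (λ u → ¬? (u ≟ v)) (Unique.allFin⁺ 9)
    d≡d∖ : ∀ x y → x ∈ˡ otherVertices v → y ∈ˡ otherVertices v → x ≢ y → d x y ≡ d∖ v x y
    d≡d∖ x y x∈ y∈ x≢y = dist∖≡d∖ v x y (∈-otherVertices⁻ x∈) (∈-otherVertices⁻ y∈) x≢y (isDist x y x∈ y∈)

  twiceW-low≤ : ∀ {W} → WienerIs E (allFin 9) W → twiceW-low ≤ 2 * W
  twiceW-low≤ {W} (d , isDist , W≡) = begin
    twiceW-low                     ≡⟨ pairSum-allFin d-low (λ x y → cong suc (𝟙nonadj-sym E x y)) ⟨
    2 * pairSum d-low (allFin 9)   ≤⟨ *-monoʳ-≤ 2 (pairSum-mono (allFin 9) (Unique.allFin⁺ 9) d-low≤d) ⟩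
    2 * pairSum d (allFin 9)       ≡⟨ cong (2 *_) W≡ ⟨
    2 * W                          ∎
    where
    open ≤-Reasoning
    d-low≤d : ∀ x y → x ∈ˡ allFin 9 → y ∈ˡ allFin 9 → x ≢ y → d-low x y ≤ d x y
    d-low≤d x y x∈ y∈ x≢y = d-low≤dist x y x≢y (isDist x y x∈ y∈)

  -- slack is chosen so that slack + cuts = 2 · d-low (slack+cuts); summed over all pairs this
  -- turns ∑twiceW∖ into deletion-identity.
  cut : Fin 9 → Fin 9 → Fin 9 → ℕ
  cut v i j = 𝟙 (adj? E i j ×-dec ¬? (adj? (E∖ v) i j))

  cuts : Fin 9 → Fin 9 → ℕ
  cuts i j = ∑ (λ v → 𝟙≢ i v * 𝟙≢ j v * cut v i j)

  slack : Fin 9 → Fin 9 → ℕ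
  slack i j = (2 + 2 * nonadj i j) ∸ cuts i j

  adjSlack : Fin 9 → Fin 9 → ℕ
  adjSlack i j = 𝟙 (adj? E i j) * slack i j

  farCount : Fin 9 → Fin 9 → ℕ
  farCount i j = ∑ (λ v → 𝟙≢ i v * 𝟙≢ j v * far∖ v i j)

  X∖ : Fin 9 → ℕ
  X∖ v = ∑≢ (λ i j → 𝟙≢ i v * 𝟙≢ j v * far∖ v i j)

  Z C S M X : ℕ
  Z = ∑≢ nonadj
  C = ∑≢ cuts
  S = ∑≢ slack
  M = ∑≢ adjSlack
  X = ∑≢ farCount

  cut≤χ : ∀ {e} v i j → e ∈ˡ E → i ∈ e → j ∈ e → cut v i j ≤ χ e v
  cut≤χ {e} v i j e∈E i∈e j∈e with v ∈? e
  ... | yes _   = 𝟙≤1 (adj? E i j ×-dec ¬? (adj? (E∖ v) i j))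
  ... | no  v∉e = ≤-reflexive (𝟙-no (adj? E i j ×-dec ¬? (adj? (E∖ v) i j))
                                    (λ (_ , ¬adj∖) → ¬adj∖ (e , ∈E∖⁺ e∈E v∉e , i∈e , j∈e)))

  cut-nonadj : ∀ v i j → ¬ Adj E i j → cut v i j ≡ 0
  cut-nonadj v i j ¬adj = 𝟙-no (adj? E i j ×-dec ¬? (adj? (E∖ v) i j)) (¬adj ∘ proj₁)

  cuts-nonadj : ∀ i j → ¬ Adj E i j → cuts i j ≡ 0
  cuts-nonadj i j ¬adj = trans (sum-cong-≗ no-cut) (∑-zero 9)
    where
    no-cut : ∀ v → 𝟙≢ i v * 𝟙≢ j v * cut v i j ≡ 0
    no-cut v rewrite cut-nonadj v i j ¬adj = *-zeroʳ (𝟙≢ i v * 𝟙≢ j v)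

  cuts≤ : ∀ {e f} i j k → i ≢ j → e ∈ˡ E → f ∈ˡ E → i ∈ e → j ∈ e → i ∈ f → j ∈ f →
          ∑ (λ v → χ e v * χ f v) ≤ k + 2 → cuts i j ≤ k
  cuts≤ {e} {f} i j k i≢j e∈E f∈E i∈e j∈e i∈f j∈f ∣e∩f∣≤k+2 = +-cancelʳ-≤ 2 (cuts i j) k (begin
    cuts i j + 2                                           ≤⟨ +-monoˡ-≤ 2 (∑-mono cut≤χ∩) ⟩
    rest + 2                                               ≡⟨ cong (rest +_) i,j∈e∩f ⟨
    rest + (χ e i * χ f i + χ e j * χ f j)                 ≡⟨ +-assoc rest _ _ ⟨
    rest + χ e i * χ f i + χ e j * χ f j                   ≡⟨ ∑-without₂ (λ v → χ e v * χ f v) i j i≢j ⟩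
    ∑ (λ v → χ e v * χ f v)                                ≤⟨ ∣e∩f∣≤k+2 ⟩
    k + 2                                                  ∎)
    where
    open ≤-Reasoning
    rest : ℕ
    rest = ∑ (λ v → 𝟙≢ i v * 𝟙≢ j v * (χ e v * χ f v))
    cut≤χ∩ : ∀ v → 𝟙≢ i v * 𝟙≢ j v * cut v i j ≤ 𝟙≢ i v * 𝟙≢ j v * (χ e v * χ f v)
    cut≤χ∩ v = *-monoʳ-≤ (𝟙≢ i v * 𝟙≢ j v)
      (≤-trans (≤-reflexive (sym (n≤1⇒n*n≡n (cut v i j) (𝟙≤1 (adj? E i j ×-dec ¬? (adj? (E∖ v) i j))))))
               (*-mono-≤ (cut≤χ v i j e∈E i∈e j∈e) (cut≤χ v i j f∈E i∈f j∈f)))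
    i,j∈e∩f : χ e i * χ f i + χ e j * χ f j ≡ 2
    i,j∈e∩f rewrite χ-∈ i∈e | χ-∈ i∈f | χ-∈ j∈e | χ-∈ j∈f = refl

  cuts≤2 : ∀ i j → i ≢ j → cuts i j ≤ 2
  cuts≤2 i j i≢j = by-cases (adj? E i j)
    where
    by-cases : Dec (Adj E i j) → cuts i j ≤ 2
    by-cases (yes (e , e∈E , i∈e , j∈e)) =
      cuts≤ i j 2 i≢j e∈E e∈E i∈e j∈e i∈e j∈e
        (≤-trans (∑-mono (λ v → ≤-reflexive (n≤1⇒n*n≡n (χ e v) (χ≤1 e v)))) (≤-reflexive (∑χ e (edge-size e∈E))))
    by-cases (no ¬adj) = ≤-trans (≤-reflexive (cuts-nonadj i j ¬adj)) z≤n

  cuts≤1 : ∀ {e f} i j → i ≢ j → e ∈ˡ E → f ∈ˡ E → e ≢ f → i ∈ e → j ∈ e → i ∈ f → j ∈ f → cuts i j ≤ 1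
  cuts≤1 i j i≢j e∈E f∈E e≢f i∈e j∈e i∈f j∈f =
    cuts≤ i j 1 i≢j e∈E f∈E i∈e j∈e i∈f j∈f (∑χ∩≤ _ _ (edge-size e∈E) (edge-size f∈E) e≢f)

  slack+cuts : ∀ i j → i ≢ j → slack i j + cuts i j ≡ 2 * d-low i j
  slack+cuts i j i≢j = trans (m∸n+n≡m (≤-trans (cuts≤2 i j i≢j) (m≤m+n 2 _)))
                             (sym (*-distribˡ-+ 2 1 (nonadj i j)))

  slack≡ : ∀ i j → slack i j ≡ 4 * nonadj i j + adjSlack i j
  slack≡ i j = by-cases (adj? E i j)
    where
    by-cases : Dec (Adj E i j) → slack i j ≡ 4 * nonadj i j + adjSlack i j
    by-cases (yes adj) = sym (cong₂ _+_ (cong (4 *_) (𝟙-no (¬? (adj? E i j)) (λ ¬adj → ¬adj adj)))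
                                        (trans (cong (_* slack i j) (𝟙-yes (adj? E i j) adj)) (+-identityʳ (slack i j))))
    by-cases (no ¬adj) = begin
      (2 + 2 * nonadj i j) ∸ cuts i j               ≡⟨ cong₂ (λ a c → (2 + 2 * a) ∸ c) nonadj≡1 (cuts-nonadj i j ¬adj) ⟩
      4                                            ≡⟨ cong₂ (λ a b → 4 * a + b * slack i j) nonadj≡1 (𝟙-no (adj? E i j) ¬adj) ⟨
      4 * nonadj i j + adjSlack i j                ∎
      where
      open ≡-Reasoning
      nonadj≡1 : nonadj i j ≡ 1
      nonadj≡1 = 𝟙-yes (¬? (adj? E i j)) ¬adj

  adjSlack-adj : ∀ i j → Adj E i j → adjSlack i j ≡ slack i j
  adjSlack-adj i j adj = trans (cong (_* slack i j) (𝟙-yes (adj? E i j) adj)) (+-identityʳ (slack i j))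

  nonadj∖≡ : ∀ v i j → nonadj∖ v i j ≡ nonadj i j + cut v i j
  nonadj∖≡ v i j with adj? E i j | adj? (E∖ v) i j
  ... | yes _    | yes _ = refl
  ... | yes _    | no  _ = refl
  ... | no  ¬adj | yes (e , e∈E∖ , i∈e , j∈e) = contradiction (e , proj₁ (∈E∖⁻ e∈E∖) , i∈e , j∈e) ¬adj
  ... | no  _    | no  _ = refl

  ∑-d∖ : ∀ i j → i ≢ j → ∑ (λ v → 𝟙≢ i v * 𝟙≢ j v * d∖ v i j) ≡ 7 * d-low i j + cuts i j + farCount i j
  ∑-d∖ i j i≢j = begin
    ∑ (λ v → a v * d∖ v i j)                                        ≡⟨ sum-cong-≗ expand ⟩
    ∑ (λ v → d-low i j * a v + a v * cut v i j + a v * far∖ v i j)  ≡⟨ ∑-distrib-+ (λ v → d-low i j * a v + a v * cut v i j) (λ v → a v * far∖ v i j) ⟩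
    ∑ (λ v → d-low i j * a v + a v * cut v i j) + farCount i j      ≡⟨ cong (_+ farCount i j) (∑-distrib-+ (λ v → d-low i j * a v) (λ v → a v * cut v i j)) ⟩
    ∑ (λ v → d-low i j * a v) + cuts i j + farCount i j             ≡⟨ cong (λ t → t + cuts i j + farCount i j) ∑d-low·a ⟩
    7 * d-low i j + cuts i j + farCount i j                         ∎
    where
    open ≡-Reasoning
    a : Fin 9 → ℕ
    a v = 𝟙≢ i v * 𝟙≢ j v
    expand : ∀ v → a v * d∖ v i j ≡ d-low i j * a v + a v * cut v i j + a v * far∖ v i j
    expand v = trans (cong (λ t → a v * (1 + t + far∖ v i j)) (nonadj∖≡ v i j))
      (solve 4 (λ a n c f → a :* (con 1 :+ (n :+ c) :+ f) := (con 1 :+ n) :* a :+ a :* c :+ a :* f) refl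
             (a v) (nonadj i j) (cut v i j) (far∖ v i j))
    ∑d-low·a : ∑ (λ v → d-low i j * a v) ≡ 7 * d-low i j
    ∑d-low·a = trans (sym (*-distribˡ-sum (d-low i j) a)) (trans (cong (d-low i j *_) (∑-𝟙≢₂ i j i≢j)) (*-comm (d-low i j) 7))

  ∑twiceW∖ : ∑ twiceW∖ ≡ 7 * twiceW-low + C + X
  ∑twiceW∖ = begin
    ∑ twiceW∖                                                   ≡⟨ ∑-∑≢-comm (λ v i j → 𝟙≢ i v * 𝟙≢ j v * d∖ v i j) ⟩
    ∑≢ (λ i j → ∑ (λ v → 𝟙≢ i v * 𝟙≢ j v * d∖ v i j))           ≡⟨ ∑≢-cong ∑-d∖ ⟩
    ∑≢ (λ i j → 7 * d-low i j + cuts i j + farCount i j)        ≡⟨ ∑≢-distrib-+ (λ i j → 7 * d-low i j + cuts i j) farCount ⟩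
    ∑≢ (λ i j → 7 * d-low i j + cuts i j) + X                   ≡⟨ cong (_+ X) (∑≢-distrib-+ (λ i j → 7 * d-low i j) cuts) ⟩
    ∑≢ (λ i j → 7 * d-low i j) + C + X                          ≡⟨ cong (λ t → t + C + X) (∑≢-*ˡ 7 d-low) ⟩
    7 * twiceW-low + C + X                                      ∎
    where open ≡-Reasoning

  S+C≡ : S + C ≡ 2 * twiceW-low
  S+C≡ = trans (sym (∑≢-distrib-+ slack cuts)) (trans (∑≢-cong slack+cuts) (∑≢-*ˡ 2 d-low))

  twiceW-low≡ : twiceW-low ≡ Z + 72
  twiceW-low≡ = trans (∑≢-distrib-+ (λ _ _ → 1) nonadj) (trans (+-comm (∑≢ {9} (λ _ _ → 1)) Z) (cong (Z +_) ∑≢1≡72))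
    where
    ∑≢1≡72 : ∑≢ {9} (λ _ _ → 1) ≡ 72
    ∑≢1≡72 = ∑≢-const {n = 8} 1

  S≡ : S ≡ 4 * Z + M
  S≡ = trans (∑≢-cong (λ i j _ → slack≡ i j))
             (trans (∑≢-distrib-+ (λ i j → 4 * nonadj i j) adjSlack) (cong (_+ M) (∑≢-*ˡ 4 nonadj)))

  X≡∑X∖ : X ≡ ∑ X∖
  X≡∑X∖ = sym (∑-∑≢-comm (λ v i j → 𝟙≢ i v * 𝟙≢ j v * far∖ v i j))

  -- Slack at a vertex

  slackAt : Fin 9 → ℕ
  slackAt x = ∑ (λ j → 𝟙≢ x j * slack x j)

  codeg : Fin 9 → Fin 9 → ℕ
  codeg x j = count (λ e → (x ∈? e) ×-dec (j ∈? e)) E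

  deg : Fin 9 → ℕ
  deg x = count (λ e → x ∈? e) E

  ∑codeg≡3deg : ∀ x → ∑ (λ j → 𝟙≢ x j * codeg x j) ≡ 3 * deg x
  ∑codeg≡3deg x = begin
    ∑ (λ j → 𝟙≢ x j * sum (map (λ e → both e j) E))       ≡⟨ sum-cong-≗ (λ j → *-distribˡ-sum-map (𝟙≢ x j) (λ e → both e j) E) ⟩
    ∑ (λ j → sum (map (λ e → 𝟙≢ x j * both e j) E))       ≡⟨ sum-∑-comm E (λ e j → 𝟙≢ x j * both e j) ⟨
    sum (map (λ e → ∑ (λ j → 𝟙≢ x j * both e j)) E)       ≡⟨ sum-map-cong E (λ e e∈E → row e∈E) ⟩
    sum (map (λ e → 3 * 𝟙 (x ∈? e)) E)                    ≡⟨ *-distribˡ-sum-map 3 (λ e → 𝟙 (x ∈? e)) E ⟨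
    3 * deg x                                             ∎
    where
    open ≡-Reasoning
    both : Subset 9 → Fin 9 → ℕ
    both e j = 𝟙 ((x ∈? e) ×-dec (j ∈? e))
    row : ∀ {e} → e ∈ˡ E → ∑ (λ j → 𝟙≢ x j * both e j) ≡ 3 * 𝟙 (x ∈? e)
    row {e} e∈E = begin
      ∑ (λ j → 𝟙≢ x j * both e j)               ≡⟨ sum-cong-≗ reorder ⟩
      ∑ (λ j → 𝟙 (x ∈? e) * (χ e j * 𝟙≢ j x))    ≡⟨ *-distribˡ-sum (𝟙 (x ∈? e)) (λ j → χ e j * 𝟙≢ j x) ⟨
      𝟙 (x ∈? e) * ∑ (λ j → χ e j * 𝟙≢ j x)      ≡⟨ by-cases (x ∈? e) ⟩
      3 * 𝟙 (x ∈? e)                            ∎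
      where
      reorder : ∀ j → 𝟙≢ x j * both e j ≡ 𝟙 (x ∈? e) * (χ e j * 𝟙≢ j x)
      reorder j rewrite 𝟙-× (x ∈? e) (j ∈? e) | 𝟙≢-sym x j =
        solve 3 (λ a b c → a :* (b :* c) := b :* (c :* a)) refl (𝟙≢ j x) (𝟙 (x ∈? e)) (χ e j)
      by-cases : (d : Dec (x ∈ e)) → 𝟙 d * ∑ (λ j → χ e j * 𝟙≢ j x) ≡ 3 * 𝟙 d
      by-cases (no  _)   = refl
      by-cases (yes x∈e) = trans (+-identityʳ _) (+-cancelˡ-≡ 1 _ 3 (begin
        1 + ∑ (λ j → χ e j * 𝟙≢ j x)      ≡⟨ cong (_+ ∑ (λ j → χ e j * 𝟙≢ j x)) (χ-∈ x∈e) ⟨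
        χ e x + ∑ (λ j → χ e j * 𝟙≢ j x)  ≡⟨ ∑-split-at (χ e) x ⟨
        ∑ (χ e)                          ≡⟨ ∑χ e (edge-size e∈E) ⟩
        4                                ∎))

  adj⇒codeg≥1 : ∀ x j → Adj E x j → 1 ≤ codeg x j
  adj⇒codeg≥1 x j (e , e∈E , x∈e , j∈e) = ∈⇒count-pos (λ e → (x ∈? e) ×-dec (j ∈? e)) e∈E (x∈e , j∈e)

  slack-nonadj : ∀ i j → ¬ Adj E i j → slack i j ≡ 4
  slack-nonadj i j ¬adj = trans (slack≡ i j) (cong₂ (λ a b → 4 * a + b * slack i j)
                                                    (𝟙-yes (¬? (adj? E i j)) ¬adj) (𝟙-no (adj? E i j) ¬adj))

  slack-adj : ∀ i j → i ≢ j → Adj E i j → slack i j + cuts i j ≡ 2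
  slack-adj i j i≢j adj = trans (slack+cuts i j i≢j) (cong (λ a → 2 * (1 + a)) (𝟙-no (¬? (adj? E i j)) (λ ¬adj → ¬adj adj)))

  two-edges⇒slack≥1 : ∀ {e f} i j → i ≢ j → e ∈ˡ E → f ∈ˡ E → e ≢ f → i ∈ e → j ∈ e → i ∈ f → j ∈ f → 1 ≤ slack i j
  two-edges⇒slack≥1 i j i≢j e∈E f∈E e≢f i∈e j∈e i∈f j∈f = +-cancelʳ-≤ (cuts i j) 1 (slack i j) (begin
    1 + cuts i j           ≤⟨ +-monoʳ-≤ 1 (cuts≤1 i j i≢j e∈E f∈E e≢f i∈e j∈e i∈f j∈f) ⟩
    2                      ≡⟨ slack-adj i j i≢j (_ , e∈E , i∈e , j∈e) ⟨
    slack i j + cuts i j   ∎)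
    where open ≤-Reasoning

  codeg≥2⇒two-edges : ∀ i j → 2 ≤ codeg i j → ∃[ e ] ∃[ f ] (e ∈ˡ E × f ∈ˡ E × e ≢ f × (i ∈ e × j ∈ e) × (i ∈ f × j ∈ f))
  codeg≥2⇒two-edges i j = count≥2⇒two∈ (λ e → (i ∈? e) ×-dec (j ∈? e)) E E-unique

  codeg≥2⇒slack≥1 : ∀ i j → i ≢ j → 2 ≤ codeg i j → 1 ≤ slack i j
  codeg≥2⇒slack≥1 i j i≢j codeg≥2 with codeg≥2⇒two-edges i j codeg≥2
  ... | e , f , e∈E , f∈E , e≢f , (i∈e , j∈e) , (i∈f , j∈f) = two-edges⇒slack≥1 i j i≢j e∈E f∈E e≢f i∈e j∈e i∈f j∈f

  cut⇒∈ : ∀ {e} u i j → 1 ≤ cut u i j → e ∈ˡ E → i ∈ e → j ∈ e → u ∈ e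
  cut⇒∈ {e} u i j cut≥1 e∈E i∈e j∈e = 𝟙-pos (u ∈? e) (≤-trans cut≥1 (cut≤χ u i j e∈E i∈e j∈e))

  cuts≥1⇒cutter : ∀ i j → 1 ≤ cuts i j → ∃[ u ] (u ≢ i × u ≢ j × 1 ≤ cut u i j)
  cuts≥1⇒cutter i j cuts≥1 =
    let (u , term≥1) = ∑-pos (λ v → 𝟙≢ i v * 𝟙≢ j v * cut v i j) cuts≥1
        (𝟙≢ᵢⱼ≥1 , cut≥1) = *-pos⇒pos (𝟙≢ i u * 𝟙≢ j u) (cut u i j) term≥1
        (i≢u , j≢u) = *-pos⇒pos (𝟙≢ i u) (𝟙≢ j u) 𝟙≢ᵢⱼ≥1
    in u , 𝟙-pos (¬? (i ≟ u)) i≢u ∘ sym , 𝟙-pos (¬? (j ≟ u)) j≢u ∘ sym , cut≥1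

  slack≤1⇒cuts≥1 : ∀ x j → x ≢ j → Adj E x j → slack x j ≤ 1 → 1 ≤ cuts x j
  slack≤1⇒cuts≥1 x j x≢j adj slack≤1 =
    +-cancelˡ-≤ 1 1 (cuts x j) (≤-trans (≤-reflexive (sym (slack-adj x j x≢j adj))) (+-monoˡ-≤ (cuts x j) slack≤1))

  slackAt-term : ∀ {x j} → x ≢ j → 𝟙≢ x j * slack x j ≡ slack x j
  slackAt-term {x} {j} x≢j = trans (cong (_* slack x j) (𝟙≢-yes x≢j)) (+-identityʳ (slack x j))

  slack≤slackAt : ∀ x j → x ≢ j → slack x j ≤ slackAt x
  slack≤slackAt x j x≢j = subst (_≤ slackAt x) (slackAt-term x≢j) (term≤∑ (λ k → 𝟙≢ x k * slack x k) j)

  slack₂≤slackAt : ∀ x j k → x ≢ j → x ≢ k → j ≢ k → slack x j + slack x k ≤ slackAt x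
  slack₂≤slackAt x j k x≢j x≢k j≢k =
    subst (_≤ slackAt x) (cong₂ _+_ (slackAt-term x≢j) (slackAt-term x≢k))
          (two-terms≤∑ (λ l → 𝟙≢ x l * slack x l) j k j≢k)

  slack₃≤slackAt : ∀ x j k l → x ≢ j → x ≢ k → x ≢ l → j ≢ k → j ≢ l → k ≢ l →
                   slack x j + slack x k + slack x l ≤ slackAt x
  slack₃≤slackAt x j k l x≢j x≢k x≢l j≢k j≢l k≢l =
    subst (_≤ slackAt x) (cong₂ _+_ (cong₂ _+_ (slackAt-term x≢j) (slackAt-term x≢k)) (slackAt-term x≢l))
          (three-terms≤∑ (λ m → 𝟙≢ x m * slack x m) j k l j≢k j≢l k≢l)

  slackAt≤1⇒adj : ∀ x → slackAt x ≤ 1 → ∀ j → x ≢ j → Adj E x j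
  slackAt≤1⇒adj x slackAt≤1 j x≢j = decidable-stable (adj? E x j) λ ¬adj →
    contradiction (≤-trans (≤-reflexive (sym (slack-nonadj x j ¬adj))) (≤-trans (slack≤slackAt x j x≢j) slackAt≤1))
                  (λ { (s≤s ()) })

  -- If every other vertex shared exactly one
  -- edge with x we would have 8 = 3 · deg x; two edges through x and j instead force a vertex u on
  -- both of them with slack x u ≥ 1 as well.
  slackAt≤1⇒codeg<2 : ∀ x → slackAt x ≤ 1 → ∀ j → x ≢ j → ¬ 2 ≤ codeg x j
  slackAt≤1⇒codeg<2 x slackAt≤1 j x≢j codeg≥2 =
    let (e , f , e∈E , f∈E , e≢f , (x∈e , j∈e) , (x∈f , j∈f)) = codeg≥2⇒two-edges x j codeg≥2
        (u , u≢x , u≢j , cut≥1) = cuts≥1⇒cutter x j cuts≥1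
        slack-xu≥1 = two-edges⇒slack≥1 x u (u≢x ∘ sym) e∈E f∈E e≢f x∈e (cut⇒∈ u x j cut≥1 e∈E x∈e j∈e)
                                                             x∈f (cut⇒∈ u x j cut≥1 f∈E x∈f j∈f)
    in contradiction (≤-trans (+-mono-≤ slack-xj≥1 slack-xu≥1)
                              (≤-trans (slack₂≤slackAt x j u x≢j (u≢x ∘ sym) (u≢j ∘ sym)) slackAt≤1)) 1+n≰n
    where
    slack-xj≥1 : 1 ≤ slack x j
    slack-xj≥1 = codeg≥2⇒slack≥1 x j x≢j codeg≥2
    cuts≥1 : 1 ≤ cuts x j
    cuts≥1 = slack≤1⇒cuts≥1 x j x≢j (slackAt≤1⇒adj x slackAt≤1 j x≢j) (≤-trans (slack≤slackAt x j x≢j) slackAt≤1)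

  slackAt≤1⇒codeg≥2 : ∀ x → slackAt x ≤ 1 → ∃[ j ] (x ≢ j × 2 ≤ codeg x j)
  slackAt≤1⇒codeg≥2 x slackAt≤1 = decidable-stable (Fin.any? (λ j → ¬? (x ≟ j) ×-dec (2 ≤? codeg x j))) λ none →
    contradiction (trans (sym (∑codeg≡3deg x)) (trans (sum-cong-≗ (codeg-one none)) (∑-𝟙≢ x))) (3∤8 (deg x))
    where
    3∤8 : ∀ d → 3 * d ≢ 8
    3∤8 (suc (suc (suc d))) 3d≡8 = 1+n≰n (≤-trans (*-monoʳ-≤ 3 (s≤s (s≤s (s≤s (z≤n {d}))))) (≤-reflexive 3d≡8))
    codeg-one : ¬ (∃[ j ] (x ≢ j × 2 ≤ codeg x j)) → ∀ j → 𝟙≢ x j * codeg x j ≡ 𝟙≢ j x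
    codeg-one none j = trans (𝟙≢-cong₁ x codeg≡1 j) (trans (*-identityʳ (𝟙≢ x j)) (𝟙≢-sym x j))
      where
      codeg≡1 : ∀ j → x ≢ j → codeg x j ≡ 1
      codeg≡1 j x≢j = ≤-antisym (≤-pred (≰⇒> (λ codeg≥2 → none (j , x≢j , codeg≥2))))
                                (adj⇒codeg≥1 x j (slackAt≤1⇒adj x slackAt≤1 j x≢j))

  slackAt≥2 : ∀ x → 2 ≤ slackAt x
  slackAt≥2 x = by-cases (2 ≤? slackAt x)
    where
    by-cases : Dec (2 ≤ slackAt x) → 2 ≤ slackAt x
    by-cases (yes ≥2) = ≥2
    by-cases (no  ≱2) = let slackAt≤1 = ≤-pred (≰⇒> ≱2)
                            (j , x≢j , codeg≥2) = slackAt≤1⇒codeg≥2 x slackAt≤1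
                        in contradiction codeg≥2 (slackAt≤1⇒codeg<2 x slackAt≤1 j x≢j)

  S≥18 : 18 ≤ S
  S≥18 = ∑-mono {g = λ i → ∑ (λ j → 𝟙≢ i j * slack i j)} slackAt≥2

  S≥slackAt+16 : ∀ x {k} → k ≤ slackAt x → k + 16 ≤ S
  S≥slackAt+16 x {k} k≤ = begin
    k + 16                                   ≤⟨ +-monoˡ-≤ 16 k≤ ⟩
    slackAt x + 2 * 8                        ≡⟨ cong (λ t → slackAt x + 2 * t) (∑-𝟙≢ x) ⟨
    slackAt x + 2 * ∑ (λ z → 𝟙≢ z x)         ≡⟨ cong (slackAt x +_) (*-distribˡ-sum 2 (λ z → 𝟙≢ z x)) ⟩
    slackAt x + ∑ (λ z → 2 * 𝟙≢ z x)         ≤⟨ +-monoʳ-≤ (slackAt x) (∑-mono (λ z → *-monoˡ-≤ (𝟙≢ z x) (slackAt≥2 z))) ⟩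
    slackAt x + ∑ (λ z → slackAt z * 𝟙≢ z x) ≡⟨ ∑-split-at slackAt x ⟨
    S                                        ∎
    where open ≤-Reasoning

  slackAt≤2⇒partner : ∀ {v a b} → slackAt v ≤ 2 → a ≢ b → v ≢ a → v ≢ b → 1 ≤ slack v a → 1 ≤ slack v b →
                      2 ≤ codeg v a → ∀ {e} → e ∈ˡ E → v ∈ e → a ∈ e → b ∈ e
  slackAt≤2⇒partner {v} {a} {b} slackAt≤2 a≢b v≢a v≢b slack-a≥1 slack-b≥1 codeg≥2 {e} e∈E v∈e a∈e =
    let (e₁ , e₂ , e₁∈E , e₂∈E , e₁≢e₂ , (v∈e₁ , a∈e₁) , (v∈e₂ , a∈e₂)) = codeg≥2⇒two-edges v a codeg≥2
        slack-a≤1 = +-cancelʳ-≤ (slack v b) (slack v a) 1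
                      (≤-trans (slack₂≤slackAt v a b v≢a v≢b a≢b) (≤-trans slackAt≤2 (+-monoʳ-≤ 1 slack-b≥1)))
        (u , u≢v , u≢a , cut≥1) = cuts≥1⇒cutter v a (slack≤1⇒cuts≥1 v a v≢a (e₁ , e₁∈E , v∈e₁ , a∈e₁) slack-a≤1)
        slack-u≥1 = two-edges⇒slack≥1 v u (u≢v ∘ sym) e₁∈E e₂∈E e₁≢e₂ v∈e₁ (cut⇒∈ u v a cut≥1 e₁∈E v∈e₁ a∈e₁)
                                                              v∈e₂ (cut⇒∈ u v a cut≥1 e₂∈E v∈e₂ a∈e₂)
    in case-u u≢v u≢a cut≥1 slack-u≥1 (u ≟ b)
    where
    case-u : ∀ {u} → u ≢ v → u ≢ a → 1 ≤ cut u v a → 1 ≤ slack v u → Dec (u ≡ b) → b ∈ e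
    case-u u≢v u≢a cut≥1 _ (yes refl) = cut⇒∈ _ v a cut≥1 e∈E v∈e a∈e
    case-u {u} u≢v u≢a _ slack-u≥1 (no u≢b) =
      contradiction (≤-trans (+-mono-≤ (+-mono-≤ slack-a≥1 slack-b≥1) slack-u≥1)
                             (≤-trans (slack₃≤slackAt v a b u v≢a v≢b (u≢v ∘ sym) a≢b (u≢a ∘ sym) (u≢b ∘ sym)) slackAt≤2))
                    λ { (s≤s (s≤s ())) }

  nonadj⇒S≥20 : ∀ x y → y ≢ x → ¬ Adj E x y → 20 ≤ S
  nonadj⇒S≥20 x y y≢x ¬adj = S≥slackAt+16 x (≤-trans (≤-reflexive (sym (slack-nonadj x y ¬adj))) (slack≤slackAt x y (y≢x ∘ sym)))

  -- Splits of H − v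

  Split-swap : ∀ {v} → Split v → Split v
  Split-swap sp = record
    { A = B ; B = A ; G = G ; A∈E = B∈E ; B∈E = A∈E ; G∈E = G∈E ; v∉A = v∉B ; v∉B = v∉A ; v∉G = v∉G
    ; A∩B=∅ = λ z z∈B z∈A → A∩B=∅ z z∈A z∈B ; p = q ; q = p ; p∈A = q∈B ; p∈G = q∈G ; q∈B = p∈A ; q∈G = p∈G }
    where open Split sp

  Meets : Subset 9 → Subset 9 → Set
  Meets e S = ∃[ z ] (z ∈ S × z ∈ e)

  meets? : ∀ e S → Dec (Meets e S)
  meets? e S = Fin.any? (λ z → (z ∈? S) ×-dec (z ∈? e))

  module AtSplit {v : Fin 9} (sp : Split v) where
    open Split sp public

    Bridge : Fin 9 → Subset 9 → Set
    Bridge z e = z ∈ e × Meets e A × Meets e B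

    Bridged : Fin 9 → Set
    Bridged z = ∃[ e ] (e ∈ˡ E∖ v × Bridge z e)

    bridged? : ∀ z → Dec (Bridged z)
    bridged? z = ∃∈? (λ e → (z ∈? e) ×-dec meets? e A ×-dec meets? e B) (E∖ v)

    𝟙bridged 𝟙lone : Fin 9 → ℕ
    𝟙bridged z = 𝟙 (bridged? z)
    𝟙lone z = 𝟙 (¬? (bridged? z))

    loneA loneB bridgedA bridgedB : Fin 9 → ℕ
    loneA z = χ A z * 𝟙lone z
    loneB z = χ B z * 𝟙lone z
    bridgedA z = χ A z * 𝟙bridged z
    bridgedB z = χ B z * 𝟙bridged z

    α β α⁺ β⁺ : ℕ
    α = ∑ loneA
    β = ∑ loneB
    α⁺ = ∑ bridgedA
    β⁺ = ∑ bridgedB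

    ∈A⇒≢v : ∀ {z} → z ∈ A → z ≢ v
    ∈A⇒≢v z∈A refl = v∉A z∈A

    ∈B⇒≢v : ∀ {z} → z ∈ B → z ≢ v
    ∈B⇒≢v z∈B refl = v∉B z∈B

    ∈A∈B⇒≢ : ∀ {i j} → i ∈ A → j ∈ B → i ≢ j
    ∈A∈B⇒≢ i∈A j∈B refl = A∩B=∅ _ i∈A j∈B

    ∈A⇒∉B : ∀ {z} → z ∈ A → z ∉ B
    ∈A⇒∉B = A∩B=∅ _

    ∈B⇒∉A : ∀ {z} → z ∈ B → z ∉ A
    ∈B⇒∉A z∈B z∈A = A∩B=∅ _ z∈A z∈B

    A⊎B : ∀ z → z ≢ v → z ∈ A ⊎ z ∈ B
    A⊎B z z≢v with z ∈? A
    ... | yes z∈A = inj₁ z∈A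
    ... | no  z∉A = inj₂ (∉A⇒∈B z z≢v z∉A)

    χA*χB≡0 : ∀ z → χ A z * χ B z ≡ 0
    χA*χB≡0 z with z ∈? A
    ... | no  _   = refl
    ... | yes z∈A = trans (+-identityʳ (χ B z)) (χ-∉ (∈A⇒∉B z∈A))

    χA·t*χB·u≡0 : ∀ (t u : Fin 9 → ℕ) z → (χ A z * t z) * (χ B z * u z) ≡ 0
    χA·t*χB·u≡0 t u z = trans (solve 4 (λ a b t u → (a :* t) :* (b :* u) := (a :* b) :* (t :* u)) refl (χ A z) (χ B z) (t z) (u z))
                         (cong (_* (t z * u z)) (χA*χB≡0 z))

    A∈E∖ : A ∈ˡ E∖ v
    A∈E∖ = ∈E∖⁺ A∈E v∉A

    B∈E∖ : B ∈ˡ E∖ v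
    B∈E∖ = ∈E∖⁺ B∈E v∉B

    adj-across⇒bridged : ∀ {i j} → i ∈ A → j ∈ B → Adj (E∖ v) i j → Bridged i × Bridged j
    adj-across⇒bridged {i} {j} i∈A j∈B (e , e∈ , i∈e , j∈e) =
      (e , e∈ , i∈e , (i , i∈A , i∈e) , (j , j∈B , j∈e)) , (e , e∈ , j∈e , (i , i∈A , i∈e) , (j , j∈B , j∈e))

    far⇒lone : ∀ {i j} → i ∈ A → j ∈ B → Far (E∖ v) i j → ¬ Bridged i × ¬ Bridged j
    far⇒lone i∈A j∈B (_ , ¬cn) =
      (λ (e , e∈ , i∈e , _ , (b , b∈B , b∈e)) → ¬cn (b , (e , e∈ , i∈e , b∈e) , (B , B∈E∖ , b∈B , j∈B))) ,
      (λ (e , e∈ , j∈e , (a , a∈A , a∈e) , _) → ¬cn (a , (A , A∈E∖ , i∈A , a∈A) , (e , e∈ , a∈e , j∈e)))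

    lone⇒far : ∀ {i j} → i ∈ A → j ∈ B → ¬ Bridged i → ¬ Bridged j → Far (E∖ v) i j
    lone⇒far {i} {j} i∈A j∈B ¬bi ¬bj = ¬bi ∘ proj₁ ∘ adj-across⇒bridged i∈A j∈B , ¬cn
      where
      ¬cn : ¬ CommonNbr (E∖ v) i j
      ¬cn (z , (e₁ , e₁∈ , i∈e₁ , z∈e₁) , (e₂ , e₂∈ , z∈e₂ , j∈e₂))
        with A⊎B z (λ { refl → proj₂ (∈E∖⁻ e₁∈) z∈e₁ })
      ... | inj₁ z∈A = ¬bj (e₂ , e₂∈ , j∈e₂ , (z , z∈A , z∈e₂) , (j , j∈B , j∈e₂))
      ... | inj₂ z∈B = ¬bi (e₁ , e₁∈ , i∈e₁ , (i , i∈A , i∈e₁) , (z , z∈B , z∈e₁))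

    far∖-across : ∀ {i j} → i ∈ A → j ∈ B → far∖ v i j ≡ 𝟙lone i * 𝟙lone j
    far∖-across {i} {j} i∈A j∈B =
      trans (𝟙-cong (far? (E∖ v) i j) (¬? (bridged? i) ×-dec ¬? (bridged? j))
                    (far⇒lone i∈A j∈B) (λ (¬bi , ¬bj) → lone⇒far i∈A j∈B ¬bi ¬bj))
            (𝟙-× (¬? (bridged? i)) (¬? (bridged? j)))

    far∖-within : ∀ {i j} (S : Subset 9) → S ∈ˡ E∖ v → i ∈ S → j ∈ S → far∖ v i j ≡ 0
    far∖-within {i} {j} S S∈ i∈S j∈S = 𝟙-no (far? (E∖ v) i j) (λ (¬adj , _) → ¬adj (S , S∈ , i∈S , j∈S))

    loneA-∉ : ∀ {z} → z ∉ A → loneA z ≡ 0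
    loneA-∉ {z} = χ*-∉ (𝟙lone z)

    loneB-∉ : ∀ {z} → z ∉ B → loneB z ≡ 0
    loneB-∉ {z} = χ*-∉ (𝟙lone z)

    lone-products-cong : ∀ {i j a b c d} → loneA i ≡ a → loneB j ≡ b → loneB i ≡ c → loneA j ≡ d →
          loneA i * loneB j + loneB i * loneA j ≡ a * b + c * d
    lone-products-cong a b c d = cong₂ _+_ (cong₂ _*_ a b) (cong₂ _*_ c d)

    X∖-term : ∀ i j → 𝟙≢ i v * 𝟙≢ j v * far∖ v i j ≡ loneA i * loneB j + loneB i * loneA j
    X∖-term i j = by-cases (i ≟ v) (j ≟ v)
      where
      by-cases : Dec (i ≡ v) → Dec (j ≡ v) → 𝟙≢ i v * 𝟙≢ j v * far∖ v i j ≡ loneA i * loneB j + loneB i * loneA j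
      by-cases (yes refl) _ = trans (cong (λ t → t * 𝟙≢ j v * far∖ v v j) (𝟙≢-refl v))
                                    (sym (lone-products-cong {v} {j} (loneA-∉ v∉A) refl (loneB-∉ v∉B) refl))
      by-cases (no _) (yes refl) = trans (cong (λ t → t * far∖ v i v) (trans (cong (𝟙≢ i v *_) (𝟙≢-refl v)) (*-zeroʳ (𝟙≢ i v))))
                                         (sym (trans (lone-products-cong {i} {v} refl (loneB-∉ v∉B) refl (loneA-∉ v∉A))
                                                     (cong₂ _+_ (*-zeroʳ (loneA i)) (*-zeroʳ (loneB i)))))
      by-cases (no i≢v) (no j≢v) = trans (cong₂ (λ a b → a * b * far∖ v i j) (𝟙≢-yes i≢v) (𝟙≢-yes j≢v))
                                         (trans (+-identityʳ (far∖ v i j)) (by-sides (A⊎B i i≢v) (A⊎B j j≢v)))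
        where
        by-sides : i ∈ A ⊎ i ∈ B → j ∈ A ⊎ j ∈ B → far∖ v i j ≡ loneA i * loneB j + loneB i * loneA j
        by-sides (inj₁ i∈A) (inj₁ j∈A) = trans (far∖-within A A∈E∖ i∈A j∈A)
          (sym (trans (lone-products-cong {i} {j} refl (loneB-∉ (∈A⇒∉B j∈A)) (loneB-∉ (∈A⇒∉B i∈A)) refl) (trans (+-identityʳ _) (*-zeroʳ (loneA i)))))
        by-sides (inj₂ i∈B) (inj₂ j∈B) = trans (far∖-within B B∈E∖ i∈B j∈B)
          (sym (trans (lone-products-cong {i} {j} (loneA-∉ (∈B⇒∉A i∈B)) refl refl (loneA-∉ (∈B⇒∉A j∈B))) (*-zeroʳ (loneB i))))
        by-sides (inj₁ i∈A) (inj₂ j∈B) = trans (far∖-across i∈A j∈B)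
          (sym (trans (lone-products-cong {i} {j} (χ*-∈ (𝟙lone i) i∈A) (χ*-∈ (𝟙lone j) j∈B) (loneB-∉ (∈A⇒∉B i∈A)) refl) (+-identityʳ _)))
        by-sides (inj₂ i∈B) (inj₁ j∈A) = trans (𝟙far-sym (E∖ v) i j) (trans (far∖-across j∈A i∈B)
          (sym (trans (lone-products-cong {i} {j} (loneA-∉ (∈B⇒∉A i∈B)) refl (χ*-∈ (𝟙lone i) i∈B) (χ*-∈ (𝟙lone j) j∈A)) (*-comm (𝟙lone i) (𝟙lone j)))))

    X∖≡αβ : X∖ v ≡ α * β + β * α
    X∖≡αβ = begin
      X∖ v                                                   ≡⟨ ∑≢-cong (λ i j _ → X∖-term i j) ⟩
      ∑≢ (λ i j → loneA i * loneB j + loneB i * loneA j)     ≡⟨ ∑≢-distrib-+ (λ i j → loneA i * loneB j) (λ i j → loneB i * loneA j) ⟩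
      ∑≢ (λ i j → loneA i * loneB j) + ∑≢ (λ i j → loneB i * loneA j)
        ≡⟨ cong₂ _+_ (∑≢-separable loneA loneB (χA·t*χB·u≡0 𝟙lone 𝟙lone))
                     (∑≢-separable loneB loneA (λ z → trans (*-comm (loneB z) (loneA z)) (χA·t*χB·u≡0 𝟙lone 𝟙lone z))) ⟩
      α * β + β * α                                          ∎
      where open ≡-Reasoning

    lone+bridged : ∀ z → 𝟙lone z + 𝟙bridged z ≡ 1
    lone+bridged z = trans (+-comm (𝟙lone z) (𝟙bridged z)) (𝟙+𝟙¬ (bridged? z))

    lone+bridged-in : ∀ (S : Subset 9) → ∣ S ∣ ≡ 4 → ∑ (λ z → χ S z * 𝟙lone z) + ∑ (λ z → χ S z * 𝟙bridged z) ≡ 4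
    lone+bridged-in S ∣S∣ = begin
      ∑ (λ z → χ S z * 𝟙lone z) + ∑ (λ z → χ S z * 𝟙bridged z)  ≡⟨ ∑-distrib-+ (λ z → χ S z * 𝟙lone z) (λ z → χ S z * 𝟙bridged z) ⟨
      ∑ (λ z → χ S z * 𝟙lone z + χ S z * 𝟙bridged z)            ≡⟨ sum-cong-≗ (λ z → sym (*-distribˡ-+ (χ S z) (𝟙lone z) (𝟙bridged z))) ⟩
      ∑ (λ z → χ S z * (𝟙lone z + 𝟙bridged z))                  ≡⟨ sum-cong-≗ (λ z → trans (cong (χ S z *_) (lone+bridged z)) (*-identityʳ (χ S z))) ⟩
      ∑ (χ S)                                                   ≡⟨ ∑χ S ∣S∣ ⟩
      4                                                         ∎
      where open ≡-Reasoning

    α+α⁺ : α + α⁺ ≡ 4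
    α+α⁺ = lone+bridged-in A (edge-size A∈E)

    β+β⁺ : β + β⁺ ≡ 4
    β+β⁺ = lone+bridged-in B (edge-size B∈E)

    G⇒bridged : ∀ {z} → z ∈ G → Bridged z
    G⇒bridged z∈G = G , ∈E∖⁺ G∈E v∉G , z∈G , (p , p∈A , p∈G) , (q , q∈B , q∈G)

    bridged-in : ∀ {S z} → z ∈ S → Bridged z → χ S z * 𝟙bridged z ≡ 1
    bridged-in {z = z} z∈S bz = trans (χ*-∈ (𝟙bridged z) z∈S) (𝟙-yes (bridged? z) bz)

    χG≤bridged : ∀ z → χ G z ≤ bridgedA z + bridgedB z
    χG≤bridged z = by-cases (z ∈? G)
      where
      by-cases : Dec (z ∈ G) → χ G z ≤ bridgedA z + bridgedB z
      by-cases (no z∉G) = ≤-trans (≤-reflexive (χ-∉ z∉G)) z≤n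
      by-cases (yes z∈G) =
        [ (λ z∈A → ≤-trans (≤-reflexive (trans (χ-∈ z∈G) (sym (bridged-in z∈A (G⇒bridged z∈G))))) (m≤m+n _ _)) ,
          (λ z∈B → ≤-trans (≤-reflexive (trans (χ-∈ z∈G) (sym (bridged-in z∈B (G⇒bridged z∈G))))) (m≤n+m _ _)) ]′
        (A⊎B z (λ { refl → v∉G z∈G }))

    α⁺+β⁺≥4 : 4 ≤ α⁺ + β⁺
    α⁺+β⁺≥4 = begin
      4                                  ≡⟨ ∑χ G (edge-size G∈E) ⟨
      ∑ (χ G)                            ≤⟨ ∑-mono χG≤bridged ⟩
      ∑ (λ z → bridgedA z + bridgedB z)  ≡⟨ ∑-distrib-+ bridgedA bridgedB ⟩
      α⁺ + β⁺                            ∎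
      where open ≤-Reasoning

    α+β≤4 : α + β ≤ 4
    α+β≤4 = +-cancelʳ-≤ (α⁺ + β⁺) (α + β) 4 (begin
      α + β + (α⁺ + β⁺)    ≡⟨ solve 4 (λ a b a⁺ b⁺ → a :+ b :+ (a⁺ :+ b⁺) := (a :+ a⁺) :+ (b :+ b⁺)) refl α β α⁺ β⁺ ⟩
      (α + α⁺) + (β + β⁺)  ≡⟨ cong₂ _+_ α+α⁺ β+β⁺ ⟩
      4 + 4                ≤⟨ +-monoʳ-≤ 4 α⁺+β⁺≥4 ⟩
      4 + (α⁺ + β⁺)        ∎)
      where open ≤-Reasoning

    a∖ : Fin 9 → Fin 9 → ℕ
    a∖ i j = 𝟙≢ i v * 𝟙≢ j v

    ∑≢a∖ : ∑≢ a∖ ≡ 56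
    ∑≢a∖ = +-cancelʳ-≡ 8 (∑≢ a∖) 56 (begin
      ∑≢ a∖ + 8                            ≡⟨ cong (∑≢ a∖ +_) diag ⟨
      ∑≢ a∖ + ∑ (λ i → 𝟙≢ i v * 𝟙≢ i v)    ≡⟨ ∑₂≡∑≢+diag a∖ ⟨
      ∑₂ a∖                                ≡⟨ ∑₂-separable (λ i → 𝟙≢ i v) (λ j → 𝟙≢ j v) ⟩
      ∑ (λ i → 𝟙≢ i v) * ∑ (λ j → 𝟙≢ j v)  ≡⟨ cong₂ _*_ (∑-𝟙≢ v) (∑-𝟙≢ v) ⟩
      64                                   ∎)
      where
      open ≡-Reasoning
      diag : ∑ (λ i → 𝟙≢ i v * 𝟙≢ i v) ≡ 8
      diag = trans (sum-cong-≗ (λ i → n≤1⇒n*n≡n (𝟙≢ i v) (𝟙≤1 (¬? (i ≟ v))))) (∑-𝟙≢ v)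

    twiceW∖-split : twiceW∖ v ≡ ∑≢ a∖ + ∑≢ (λ i j → a∖ i j * nonadj∖ v i j) + X∖ v
    twiceW∖-split = begin
      ∑≢ (λ i j → a∖ i j * d∖ v i j)
        ≡⟨ ∑≢-cong (λ i j _ → expand i j) ⟩
      ∑≢ (λ i j → a∖ i j + a∖ i j * nonadj∖ v i j + a∖ i j * far∖ v i j)
        ≡⟨ ∑≢-distrib-+ (λ i j → a∖ i j + a∖ i j * nonadj∖ v i j) (λ i j → a∖ i j * far∖ v i j) ⟩
      ∑≢ (λ i j → a∖ i j + a∖ i j * nonadj∖ v i j) + X∖ v
        ≡⟨ cong (_+ X∖ v) (∑≢-distrib-+ a∖ (λ i j → a∖ i j * nonadj∖ v i j)) ⟩
      ∑≢ a∖ + ∑≢ (λ i j → a∖ i j * nonadj∖ v i j) + X∖ v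
        ∎
      where
      open ≡-Reasoning
      expand : ∀ i j → a∖ i j * d∖ v i j ≡ a∖ i j + a∖ i j * nonadj∖ v i j + a∖ i j * far∖ v i j
      expand i j = solve 3 (λ a n f → a :* (con 1 :+ n :+ f) := a :+ a :* n :+ a :* f) refl (a∖ i j) (nonadj∖ v i j) (far∖ v i j)

    acrossAB bridgedAcrossAB : Fin 9 → Fin 9 → ℕ
    acrossAB i j = χ A i * χ B j + χ B i * χ A j
    bridgedAcrossAB i j = bridgedA i * bridgedB j + bridgedB i * bridgedA j

    ∑≢acrossAB : ∑≢ acrossAB ≡ 32
    ∑≢acrossAB = begin
      ∑≢ acrossAB                                                     ≡⟨ ∑≢-distrib-+ (λ i j → χ A i * χ B j) (λ i j → χ B i * χ A j) ⟩
      ∑≢ (λ i j → χ A i * χ B j) + ∑≢ (λ i j → χ B i * χ A j)   ≡⟨ cong₂ _+_ (∑≢-separable (χ A) (χ B) χA*χB≡0)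
                                                                            (∑≢-separable (χ B) (χ A) (λ z → trans (*-comm (χ B z) (χ A z)) (χA*χB≡0 z))) ⟩
      ∑ (χ A) * ∑ (χ B) + ∑ (χ B) * ∑ (χ A)                     ≡⟨ cong₂ (λ a b → a * b + b * a) (∑χ A (edge-size A∈E)) (∑χ B (edge-size B∈E)) ⟩
      32                                                        ∎
      where open ≡-Reasoning

    ∑≢bridgedAcrossAB : ∑≢ bridgedAcrossAB ≡ α⁺ * β⁺ + β⁺ * α⁺
    ∑≢bridgedAcrossAB = trans (∑≢-distrib-+ (λ i j → bridgedA i * bridgedB j) (λ i j → bridgedB i * bridgedA j))
                 (cong₂ _+_ (∑≢-separable bridgedA bridgedB (χA·t*χB·u≡0 𝟙bridged 𝟙bridged))
                            (∑≢-separable bridgedB bridgedA (λ z → trans (*-comm (bridgedB z) (bridgedA z)) (χA·t*χB·u≡0 𝟙bridged 𝟙bridged z))))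

    cross-AB : ∀ {i j} → i ∈ A → j ∈ B → 1 ≤ a∖ i j * nonadj∖ v i j + bridgedA i * bridgedB j
    cross-AB {i} {j} i∈A j∈B = by-cases (bridged? i) (bridged? j)
      where
      a·n≡1 : ¬ Adj (E∖ v) i j → a∖ i j * nonadj∖ v i j ≡ 1
      a·n≡1 ¬adj = cong₂ _*_ (cong₂ _*_ (𝟙≢-yes (∈A⇒≢v i∈A)) (𝟙≢-yes (∈B⇒≢v j∈B))) (𝟙-yes (¬? (adj? (E∖ v) i j)) ¬adj)
      by-cases : Dec (Bridged i) → Dec (Bridged j) → 1 ≤ a∖ i j * nonadj∖ v i j + bridgedA i * bridgedB j
      by-cases (yes bi) (yes bj) = ≤-trans (≤-reflexive (sym (cong₂ _*_ (bridged-in i∈A bi) (bridged-in j∈B bj)))) (m≤n+m _ _)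
      by-cases (no ¬bi) _        = ≤-trans (≤-reflexive (sym (a·n≡1 (¬bi ∘ proj₁ ∘ adj-across⇒bridged i∈A j∈B)))) (m≤m+n _ _)
      by-cases (yes _)  (no ¬bj) = ≤-trans (≤-reflexive (sym (a·n≡1 (¬bj ∘ proj₂ ∘ adj-across⇒bridged i∈A j∈B)))) (m≤m+n _ _)

    cross-pt : ∀ i j → acrossAB i j ≤ a∖ i j * nonadj∖ v i j + bridgedAcrossAB i j
    cross-pt i j = by-cases (i ∈? A) (j ∈? B) (i ∈? B) (j ∈? A)
      where
      0ˡ : ∀ {S k} t → k ∉ S → χ S k * t ≡ 0
      0ˡ t k∉S = χ*-∉ t k∉S
      0ʳ : ∀ {S k} t → k ∉ S → t * χ S k ≡ 0
      0ʳ t k∉S = trans (cong (t *_) (χ-∉ k∉S)) (*-zeroʳ t)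
      none : χ A i * χ B j ≡ 0 → χ B i * χ A j ≡ 0 → acrossAB i j ≤ a∖ i j * nonadj∖ v i j + bridgedAcrossAB i j
      none h₁ h₂ = ≤-trans (≤-reflexive (cong₂ _+_ h₁ h₂)) z≤n
      by-cases : Dec (i ∈ A) → Dec (j ∈ B) → Dec (i ∈ B) → Dec (j ∈ A) → acrossAB i j ≤ a∖ i j * nonadj∖ v i j + bridgedAcrossAB i j
      by-cases (yes i∈A) (yes j∈B) _ _ = begin
        acrossAB i j                                                   ≡⟨ cong₂ _+_ (cong₂ _*_ (χ-∈ i∈A) (χ-∈ j∈B)) (0ˡ (χ A j) (∈A⇒∉B i∈A)) ⟩
        1                                                        ≤⟨ cross-AB i∈A j∈B ⟩
        a∖ i j * nonadj∖ v i j + bridgedA i * bridgedB j         ≤⟨ +-monoʳ-≤ (a∖ i j * nonadj∖ v i j) (m≤m+n _ _) ⟩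
        a∖ i j * nonadj∖ v i j + bridgedAcrossAB i j                          ∎
        where open ≤-Reasoning
      by-cases _ _ (yes i∈B) (yes j∈A) = begin
        acrossAB i j                                                   ≡⟨ cong₂ _+_ (0ʳ (χ A i) (∈A⇒∉B j∈A)) (cong₂ _*_ (χ-∈ i∈B) (χ-∈ j∈A)) ⟩
        1                                                        ≤⟨ cross-AB j∈A i∈B ⟩
        a∖ j i * nonadj∖ v j i + bridgedA j * bridgedB i         ≡⟨ cong₂ _+_ (cong₂ _*_ (*-comm (𝟙≢ j v) (𝟙≢ i v)) (𝟙nonadj-sym (E∖ v) j i))
                                                                              (*-comm (bridgedA j) (bridgedB i)) ⟩
        a∖ i j * nonadj∖ v i j + bridgedB i * bridgedA j         ≤⟨ +-monoʳ-≤ (a∖ i j * nonadj∖ v i j) (m≤n+m _ _) ⟩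
        a∖ i j * nonadj∖ v i j + bridgedAcrossAB i j                          ∎
        where open ≤-Reasoning
      by-cases (no i∉A) _         (no i∉B) _         = none (0ˡ (χ B j) i∉A) (0ˡ (χ A j) i∉B)
      by-cases (no i∉A) _         (yes _)  (no j∉A)  = none (0ˡ (χ B j) i∉A) (0ʳ (χ B i) j∉A)
      by-cases (yes _)  (no j∉B)  (no i∉B) _         = none (0ʳ (χ A i) j∉B) (0ˡ (χ A j) i∉B)
      by-cases (yes _)  (no j∉B)  (yes _)  (no j∉A)  = none (0ʳ (χ A i) j∉B) (0ʳ (χ B i) j∉A)

    twiceW∖-lower : X∖ v + 88 ≤ twiceW∖ v + (α⁺ * β⁺ + β⁺ * α⁺)
    twiceW∖-lower = begin
      X∖ v + 88
        ≡⟨ cong (X∖ v +_) ∑≢a∖+∑≢acrossAB ⟨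
      X∖ v + (∑≢ a∖ + ∑≢ acrossAB)
        ≡⟨ +-comm (X∖ v) (∑≢ a∖ + ∑≢ acrossAB) ⟩
      ∑≢ a∖ + ∑≢ acrossAB + X∖ v
        ≤⟨ +-monoˡ-≤ (X∖ v) (+-monoʳ-≤ (∑≢ a∖) (∑≢-mono (λ i j _ → cross-pt i j))) ⟩
      ∑≢ a∖ + ∑≢ (λ i j → a∖ i j * nonadj∖ v i j + bridgedAcrossAB i j) + X∖ v
        ≡⟨ cong (λ t → ∑≢ a∖ + t + X∖ v) (∑≢-distrib-+ (λ i j → a∖ i j * nonadj∖ v i j) bridgedAcrossAB) ⟩
      ∑≢ a∖ + (∑≢ (λ i j → a∖ i j * nonadj∖ v i j) + ∑≢ bridgedAcrossAB) + X∖ v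
        ≡⟨ solve 4 (λ a n c x → a :+ (n :+ c) :+ x := a :+ n :+ x :+ c) refl
                                                                               (∑≢ a∖) (∑≢ (λ i j → a∖ i j * nonadj∖ v i j)) (∑≢ bridgedAcrossAB) (X∖ v) ⟩
      ∑≢ a∖ + ∑≢ (λ i j → a∖ i j * nonadj∖ v i j) + X∖ v + ∑≢ bridgedAcrossAB
        ≡⟨ cong₂ _+_ twiceW∖-split (sym ∑≢bridgedAcrossAB) ⟨
      twiceW∖ v + (α⁺ * β⁺ + β⁺ * α⁺)
        ∎
      where
      open ≤-Reasoning
      ∑≢a∖+∑≢acrossAB : ∑≢ a∖ + ∑≢ acrossAB ≡ 88
      ∑≢a∖+∑≢acrossAB = cong₂ _+_ ∑≢a∖ ∑≢acrossAB

  module _ {v : Fin 9} (sp : Split v) where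
    private
      module S = AtSplit sp
      module S′ = AtSplit (Split-swap sp)

    private
      swap : ∀ {z X Y} → ∃[ e ] (e ∈ˡ E∖ v × z ∈ e × Meets e X × Meets e Y) → ∃[ e ] (e ∈ˡ E∖ v × z ∈ e × Meets e Y × Meets e X)
      swap (e , e∈ , z∈e , mX , mY) = e , e∈ , z∈e , mY , mX

    Bridged-swap : ∀ {z} → S′.Bridged z → S.Bridged z
    Bridged-swap = swap

    𝟙lone-swap : ∀ z → S′.𝟙lone z ≡ S.𝟙lone z
    𝟙lone-swap z = 𝟙-cong (¬? (S′.bridged? z)) (¬? (S.bridged? z)) (λ ¬b′ b → ¬b′ (swap b)) (λ ¬b b′ → ¬b (swap b′))

    α-swap : S′.α ≡ S.β
    α-swap = sum-cong-≗ (λ z → cong (χ S.B z *_) (𝟙lone-swap z))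

    β-swap : S′.β ≡ S.α
    β-swap = sum-cong-≗ (λ z → cong (χ S.A z *_) (𝟙lone-swap z))

  -- Slack inside the bridging edge

  module Overlap {e f : Subset 9} (e∈E : e ∈ˡ E) (f∈E : f ∈ˡ E) where

    χ∩ : Fin 9 → ℕ
    χ∩ z = χ e z * χ f z

    size : ℕ
    size = ∑ χ∩

    χ∩≤1 : ∀ z → χ∩ z ≤ 1
    χ∩≤1 z = *-mono-≤ (χ≤1 e z) (χ≤1 f z)

    χ∩-pos : ∀ {z} → 1 ≤ χ∩ z → z ∈ e × z ∈ f
    χ∩-pos {z} h = let (he , hf) = *-pos⇒pos (χ e z) (χ f z) h in 𝟙-pos (z ∈? e) he , 𝟙-pos (z ∈? f) hf

    inner-pairs : ∑≢ (λ i j → χ∩ i * χ∩ j) + size ≡ size * size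
    inner-pairs = begin
      ∑≢ (λ i j → χ∩ i * χ∩ j) + size                     ≡⟨ cong (∑≢ (λ i j → χ∩ i * χ∩ j) +_) diag ⟨
      ∑≢ (λ i j → χ∩ i * χ∩ j) + ∑ (λ i → χ∩ i * χ∩ i)    ≡⟨ ∑₂≡∑≢+diag (λ i j → χ∩ i * χ∩ j) ⟨
      ∑₂ (λ i j → χ∩ i * χ∩ j)                            ≡⟨ ∑₂-separable χ∩ χ∩ ⟩
      size * size                                         ∎
      where
      open ≡-Reasoning
      diag : ∑ (λ i → χ∩ i * χ∩ i) ≡ size
      diag = sum-cong-≗ (λ i → n≤1⇒n*n≡n (χ∩ i) (χ∩≤1 i))

    module _ (k : ℕ) (size≤k+2 : size ≤ k + 2) where

      2∸k≤adjSlack : ∀ i j → i ≢ j → 1 ≤ χ∩ i → 1 ≤ χ∩ j → 2 ∸ k ≤ adjSlack i j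
      2∸k≤adjSlack i j i≢j χ∩i≥1 χ∩j≥1 =
        let (i∈e , i∈f) = χ∩-pos χ∩i≥1
            (j∈e , j∈f) = χ∩-pos χ∩j≥1
            adj = (e , e∈E , i∈e , j∈e)
        in begin
          2 ∸ k                    ≤⟨ ∸-monoʳ-≤ 2 (cuts≤ i j k i≢j e∈E f∈E i∈e j∈e i∈f j∈f size≤k+2) ⟩
          2 ∸ cuts i j             ≡⟨ cong (_∸ cuts i j) (slack-adj i j i≢j adj) ⟨
          slack i j + cuts i j ∸ cuts i j ≡⟨ m+n∸n≡m (slack i j) (cuts i j) ⟩
          slack i j                ≡⟨ adjSlack-adj i j adj ⟨
          adjSlack i j             ∎
        where open ≤-Reasoning

      inner-adjSlack : ∑≢ (λ i j → χ∩ i * χ∩ j) * (2 ∸ k) ≤ ∑≢ (λ i j → χ∩ i * χ∩ j * adjSlack i j)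
      inner-adjSlack = begin
        ∑≢ (λ i j → χ∩ i * χ∩ j) * (2 ∸ k)                ≡⟨ *-comm _ (2 ∸ k) ⟩
        (2 ∸ k) * ∑≢ (λ i j → χ∩ i * χ∩ j)                ≡⟨ ∑≢-*ˡ (2 ∸ k) (λ i j → χ∩ i * χ∩ j) ⟨
        ∑≢ (λ i j → (2 ∸ k) * (χ∩ i * χ∩ j))              ≤⟨ ∑≢-mono pointwise ⟩
        ∑≢ (λ i j → χ∩ i * χ∩ j * adjSlack i j)           ∎
        where
        open ≤-Reasoning
        pointwise : ∀ i j → i ≢ j → (2 ∸ k) * (χ∩ i * χ∩ j) ≤ χ∩ i * χ∩ j * adjSlack i j
        pointwise i j i≢j = by-cases (1 ≤? χ∩ i) (1 ≤? χ∩ j)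
          where
          by-cases : Dec (1 ≤ χ∩ i) → Dec (1 ≤ χ∩ j) → (2 ∸ k) * (χ∩ i * χ∩ j) ≤ χ∩ i * χ∩ j * adjSlack i j
          by-cases (yes χ∩i≥1) (yes χ∩j≥1) =
            ≤-trans (≤-reflexive (*-comm (2 ∸ k) (χ∩ i * χ∩ j))) (*-monoʳ-≤ (χ∩ i * χ∩ j) (2∸k≤adjSlack i j i≢j χ∩i≥1 χ∩j≥1))
          by-cases (no χ∩i≱1) _ =
            ≤-trans (≤-reflexive (trans (cong (λ t → (2 ∸ k) * (t * χ∩ j)) (n<1⇒n≡0 (≰⇒> χ∩i≱1))) (*-zeroʳ (2 ∸ k)))) z≤n
          by-cases (yes _) (no χ∩j≱1) =
            ≤-trans (≤-reflexive (trans (cong (λ t → (2 ∸ k) * (χ∩ i * t)) (n<1⇒n≡0 (≰⇒> χ∩j≱1)))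
                                        (trans (cong ((2 ∸ k) *_) (*-zeroʳ (χ∩ i))) (*-zeroʳ (2 ∸ k))))) z≤n

    size≡2⇒another : size ≡ 2 → ∀ j → ∃[ j′ ] (j′ ∈ e × j′ ∈ f × j′ ≢ j)
    size≡2⇒another size≡2 j =
      let (j′ , χ∩≥1 , j′≢j) = ∑≥2⇒∃≢ χ∩ χ∩≤1 (≤-reflexive (sym size≡2)) j
          (j′∈e , j′∈f) = χ∩-pos χ∩≥1
      in j′ , j′∈e , j′∈f , j′≢j

    inner-pairs-count : ∀ {s p} → size ≡ s → p + s ≡ s * s → ∑≢ (λ i j → χ∩ i * χ∩ j) ≡ p
    inner-pairs-count {s} {p} size≡s p+s≡s² = +-cancelʳ-≡ s _ p (trans (subst (λ t → ∑≢ (λ i j → χ∩ i * χ∩ j) + t ≡ t * t) size≡s inner-pairs) (sym p+s≡s²))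

    inner-adjSlack₂ : size ≡ 2 → 4 ≤ ∑≢ (λ i j → χ∩ i * χ∩ j * adjSlack i j)
    inner-adjSlack₂ size≡2 = subst (λ p → p * 2 ≤ ∑≢ (λ i j → χ∩ i * χ∩ j * adjSlack i j))
                                   (inner-pairs-count {p = 2} size≡2 refl) (inner-adjSlack 0 (≤-reflexive size≡2))

    inner-adjSlack₃ : size ≡ 3 → 6 ≤ ∑≢ (λ i j → χ∩ i * χ∩ j * adjSlack i j)
    inner-adjSlack₃ size≡3 = subst (λ p → p * 1 ≤ ∑≢ (λ i j → χ∩ i * χ∩ j * adjSlack i j))
                                   (inner-pairs-count {p = 6} size≡3 refl) (inner-adjSlack 1 (≤-reflexive size≡3))

  module SplitOverlaps {v : Fin 9} (sp : Split v) where
    open AtSplit sp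

    module A∩G = Overlap A∈E G∈E
    module B∩G = Overlap B∈E G∈E

    regionA regionB rowV : ℕ
    regionA = ∑≢ (λ i j → A∩G.χ∩ i * A∩G.χ∩ j * adjSlack i j)
    regionB = ∑≢ (λ i j → B∩G.χ∩ i * B∩G.χ∩ j * adjSlack i j)
    rowV = ∑ (λ j → 𝟙≢ v j * adjSlack v j)

    ∣A∩G∣+∣B∩G∣ : A∩G.size + B∩G.size ≡ 4
    ∣A∩G∣+∣B∩G∣ = trans (sym (∑-distrib-+ A∩G.χ∩ B∩G.χ∩)) (trans (sum-cong-≗ split-G) (∑χ G (edge-size G∈E)))
      where
      split-G : ∀ z → A∩G.χ∩ z + B∩G.χ∩ z ≡ χ G z
      split-G z with z ∈? G
      ... | no  _   = cong₂ _+_ (*-zeroʳ (χ A z)) (*-zeroʳ (χ B z))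
      ... | yes z∈G with A⊎B z (λ { refl → v∉G z∈G })
      ...   | inj₁ z∈A = cong₂ _+_ (χ*-∈ 1 z∈A) (χ*-∉ 1 (∈A⇒∉B z∈A))
      ...   | inj₂ z∈B = cong₂ _+_ (χ*-∉ 1 (∈B⇒∉A z∈B)) (χ*-∈ 1 z∈B)

    ∣S∩G∣≤ : ∀ S z → χ S z * χ G z ≤ χ S z * 𝟙bridged z
    ∣S∩G∣≤ S z = by-cases (z ∈? G)
      where
      by-cases : Dec (z ∈ G) → χ S z * χ G z ≤ χ S z * 𝟙bridged z
      by-cases (no z∉G)  = ≤-trans (≤-reflexive (trans (cong (χ S z *_) (χ-∉ z∉G)) (*-zeroʳ (χ S z)))) z≤n
      by-cases (yes z∈G) = ≤-reflexive (cong (χ S z *_) (trans (χ-∈ z∈G) (sym (𝟙-yes (bridged? z) (G⇒bridged z∈G)))))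

    ∣A∩G∣≤α⁺ : A∩G.size ≤ α⁺
    ∣A∩G∣≤α⁺ = ∑-mono (∣S∩G∣≤ A)

    ∣B∩G∣≤β⁺ : B∩G.size ≤ β⁺
    ∣B∩G∣≤β⁺ = ∑-mono (∣S∩G∣≤ B)

    regions≤M : regionA + regionB + rowV ≤ M
    regions≤M = begin
      regionA + regionB + rowV                                ≡⟨ cong (regionA + regionB +_) (∑≢-row adjSlack v) ⟨
      regionA + regionB + ∑≢ (λ i j → 𝟙 (i ≟ v) * adjSlack i j)
        ≡⟨ cong (_+ ∑≢ (λ i j → 𝟙 (i ≟ v) * adjSlack i j)) (∑≢-distrib-+ (λ i j → inA i j * adjSlack i j) (λ i j → inB i j * adjSlack i j)) ⟨
      ∑≢ (λ i j → inA i j * adjSlack i j + inB i j * adjSlack i j) + ∑≢ (λ i j → 𝟙 (i ≟ v) * adjSlack i j)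
        ≡⟨ ∑≢-distrib-+ (λ i j → inA i j * adjSlack i j + inB i j * adjSlack i j) (λ i j → 𝟙 (i ≟ v) * adjSlack i j) ⟨
      ∑≢ (λ i j → inA i j * adjSlack i j + inB i j * adjSlack i j + 𝟙 (i ≟ v) * adjSlack i j)
        ≤⟨ ∑≢-mono (λ i j _ → pointwise i j) ⟩
      M                                                       ∎
      where
      open ≤-Reasoning
      inA inB : Fin 9 → Fin 9 → ℕ
      inA i j = A∩G.χ∩ i * A∩G.χ∩ j
      inB i j = B∩G.χ∩ i * B∩G.χ∩ j
      inA≤1 : ∀ i j → inA i j ≤ 1
      inA≤1 i j = *-mono-≤ (A∩G.χ∩≤1 i) (A∩G.χ∩≤1 j)
      inB≤1 : ∀ i j → inB i j ≤ 1
      inB≤1 i j = *-mono-≤ (B∩G.χ∩≤1 i) (B∩G.χ∩≤1 j)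
      inA-∉ : ∀ {i} j → i ∉ A → inA i j ≡ 0
      inA-∉ {i} j i∉A = cong (λ a → a * χ G i * A∩G.χ∩ j) (χ-∉ i∉A)
      inB-∉ : ∀ {i} j → i ∉ B → inB i j ≡ 0
      inB-∉ {i} j i∉B = cong (λ a → a * χ G i * B∩G.χ∩ j) (χ-∉ i∉B)
      at-most-one : ∀ i j → inA i j + inB i j + 𝟙 (i ≟ v) ≤ 1
      at-most-one i j with i ≟ v
      ... | yes refl = ≤-reflexive (cong₂ (λ a b → a + b + 1) (inA-∉ j v∉A) (inB-∉ j v∉B))
      ... | no  i≢v with A⊎B i i≢v
      ...   | inj₁ i∈A = subst (λ b → inA i j + b + 0 ≤ 1) (sym (inB-∉ j (∈A⇒∉B i∈A)))
                               (subst (_≤ 1) (sym (trans (+-identityʳ _) (+-identityʳ _))) (inA≤1 i j))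
      ...   | inj₂ i∈B = subst (λ a → a + inB i j + 0 ≤ 1) (sym (inA-∉ j (∈B⇒∉A i∈B)))
                               (subst (_≤ 1) (sym (+-identityʳ _)) (inB≤1 i j))
      pointwise : ∀ i j → inA i j * adjSlack i j + inB i j * adjSlack i j + 𝟙 (i ≟ v) * adjSlack i j ≤ adjSlack i j
      pointwise i j = begin
        inA i j * adjSlack i j + inB i j * adjSlack i j + 𝟙 (i ≟ v) * adjSlack i j
          ≡⟨ solve 4 (λ a b c m → a :* m :+ b :* m :+ c :* m := (a :+ b :+ c) :* m) refl (inA i j) (inB i j) (𝟙 (i ≟ v)) (adjSlack i j) ⟩
        (inA i j + inB i j + 𝟙 (i ≟ v)) * adjSlack i j  ≤⟨ *-monoˡ-≤ (adjSlack i j) (at-most-one i j) ⟩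
        1 * adjSlack i j                                ≡⟨ *-identityˡ (adjSlack i j) ⟩
        adjSlack i j                                    ∎

    ∣B∩G∣≡4∸∣A∩G∣ : ∀ {k} → A∩G.size ≡ k → B∩G.size ≡ 4 ∸ k
    ∣B∩G∣≡4∸∣A∩G∣ {k} kA≡k = trans (sym (m+n∸m≡n A∩G.size B∩G.size)) (cong₂ _∸_ ∣A∩G∣+∣B∩G∣ kA≡k)

    M≥6 : α⁺ ≡ 3 → β⁺ ≡ 2 → 6 ≤ M
    M≥6 α⁺≡3 β⁺≡2 = ≤-trans (by-size A∩G.size refl) (≤-trans (m≤m+n (regionA + regionB) rowV) regions≤M)
      where
      by-size : ∀ k → A∩G.size ≡ k → 6 ≤ regionA + regionB
      ∣B∩G∣≤2 : B∩G.size ≤ 2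
      ∣B∩G∣≤2 = subst (B∩G.size ≤_) β⁺≡2 ∣B∩G∣≤β⁺
      by-size 0 kA≡0 = contradiction (subst (_≤ 2) (∣B∩G∣≡4∸∣A∩G∣ kA≡0) ∣B∩G∣≤2) λ { (s≤s (s≤s ())) }
      by-size 1 kA≡1 = contradiction (subst (_≤ 2) (∣B∩G∣≡4∸∣A∩G∣ kA≡1) ∣B∩G∣≤2) λ { (s≤s (s≤s ())) }
      by-size 2 kA≡2 = ≤-trans (m≤m+n 6 2) (+-mono-≤ (A∩G.inner-adjSlack₂ kA≡2) (B∩G.inner-adjSlack₂ (∣B∩G∣≡4∸∣A∩G∣ kA≡2)))
      by-size 3 kA≡3 = ≤-trans (A∩G.inner-adjSlack₃ kA≡3) (m≤m+n regionA regionB)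
      by-size (suc (suc (suc (suc k)))) kA≡4+k = contradiction (subst (_≤ 3) kA≡4+k (subst (A∩G.size ≤_) α⁺≡3 ∣A∩G∣≤α⁺)) λ { (s≤s (s≤s (s≤s ()))) }

    module _ (α⁺+β⁺≤4 : α⁺ + β⁺ ≤ 4) where

      -- Now every bridged vertex lies in G, so an edge of H − v lies in A, in B or equals G. An edge
      -- through j ∈ S missing another vertex j′ of S ∩ G is none of these, hence it contains v.
      bridged⇒∈G : ∀ z → z ≢ v → Bridged z → z ∈ G
      bridged⇒∈G z z≢v bz = 𝟙-pos (z ∈? G) (≤-trans bridged≥1 (∑-mono-tight (χ G) (λ z → bridgedA z + bridgedB z) χG≤bridged ∑≤∑χG z))
        where
        ∑≤∑χG : ∑ (λ z → bridgedA z + bridgedB z) ≤ ∑ (χ G)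
        ∑≤∑χG = ≤-trans (≤-reflexive (∑-distrib-+ bridgedA bridgedB)) (≤-trans α⁺+β⁺≤4 (≤-reflexive (sym (∑χ G (edge-size G∈E)))))
        bridged≥1 : 1 ≤ bridgedA z + bridgedB z
        bridged≥1 = [ (λ z∈A → ≤-trans (≤-reflexive (sym (bridged-in z∈A bz))) (m≤m+n _ _)) ,
                      (λ z∈B → ≤-trans (≤-reflexive (sym (bridged-in z∈B bz))) (m≤n+m _ _)) ]′ (A⊎B z z≢v)

      crossing⇒G⊆ : ∀ {e} → e ∈ˡ E∖ v → Meets e A → Meets e B → G ⊆ e
      crossing⇒G⊆ {e} e∈ mA mB = ⊆∧∣≡∣⇒⊇ e⊆G (trans (edge-size (proj₁ (∈E∖⁻ e∈))) (sym (edge-size G∈E)))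
        where
        e⊆G : e ⊆ G
        e⊆G {z} z∈e = bridged⇒∈G z (λ { refl → proj₂ (∈E∖⁻ e∈) z∈e }) (e , e∈ , z∈e , mA , mB)

      v-adj-side : ∀ {S O} → S ∈ˡ E → (∀ z → z ≢ v → z ∉ S → z ∈ O) →
                   (∀ {e} → e ∈ˡ E∖ v → Meets e S → Meets e O → G ⊆ e) →
                   ∀ {j j′} → j ∈ S → j′ ∈ S → j′ ∈ G → j′ ≢ j → Adj E v j
      v-adj-side {S} {O} S∈E ∉S⇒∈O crossing {j} {j′} j∈S j′∈S j′∈G j′≢j = through (edge-avoiding j′ j (j′≢j ∘ sym))
        where
        through : ∃[ e ] (e ∈ˡ E × j′ ∉ e × j ∈ e) → Adj E v j
        through (e , e∈E , j′∉e , j∈e) = by-v (v ∈? e)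
          where
          e⊆S : v ∉ e → ¬ Meets e O → e ⊆ S
          e⊆S v∉e ¬meets-O {z} z∈e = decidable-stable (z ∈? S)
            (λ z∉S → ¬meets-O (z , ∉S⇒∈O z (λ { refl → v∉e z∈e }) z∉S , z∈e))
          by-v : Dec (v ∈ e) → Adj E v j
          by-v (yes v∈e) = e , e∈E , v∈e , j∈e
          by-v (no  v∉e) = contradiction (by-O (meets? e O)) j′∉e
            where
            by-O : Dec (Meets e O) → j′ ∈ e
            by-O (yes meets-O) = crossing (∈E∖⁺ e∈E v∉e) (j , j∈S , j∈e) meets-O j′∈G
            by-O (no ¬meets-O) = ⊆∧∣≡∣⇒⊇ (e⊆S v∉e ¬meets-O) (trans (edge-size e∈E) (sym (edge-size S∈E))) j′∈S

      v-adj-all : A∩G.size ≡ 2 → B∩G.size ≡ 2 → ∀ j → j ≢ v → Adj E v j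
      v-adj-all ∣A∩G∣≡2 ∣B∩G∣≡2 j j≢v = [ in-A , in-B ]′ (A⊎B j j≢v)
        where
        ∉B⇒∈A : ∀ z → z ≢ v → z ∉ B → z ∈ A
        ∉B⇒∈A z z≢v z∉B = [ id , (λ z∈B → contradiction z∈B z∉B) ]′ (A⊎B z z≢v)
        in-A : j ∈ A → Adj E v j
        in-A j∈A = let (j′ , j′∈A , j′∈G , j′≢j) = A∩G.size≡2⇒another ∣A∩G∣≡2 j
                   in v-adj-side A∈E ∉A⇒∈B crossing⇒G⊆ j∈A j′∈A j′∈G j′≢j
        in-B : j ∈ B → Adj E v j
        in-B j∈B = let (j′ , j′∈B , j′∈G , j′≢j) = B∩G.size≡2⇒another ∣B∩G∣≡2 j
                   in v-adj-side B∈E ∉B⇒∈A (λ e∈ mB mA → crossing⇒G⊆ e∈ mA mB) j∈B j′∈B j′∈G j′≢j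

    M≥10 : α⁺ ≡ 2 → β⁺ ≡ 2 → 10 ≤ M
    M≥10 α⁺≡2 β⁺≡2 = ≤-trans (+-mono-≤ (+-mono-≤ (A∩G.inner-adjSlack₂ ∣A∩G∣≡2) (B∩G.inner-adjSlack₂ ∣B∩G∣≡2)) rowV≥2) regions≤M
      where
      ∣A∩G∣≡2 : A∩G.size ≡ 2
      ∣A∩G∣≡2 = ≤-antisym (subst (A∩G.size ≤_) α⁺≡2 ∣A∩G∣≤α⁺)
                  (+-cancelʳ-≤ B∩G.size 2 A∩G.size (≤-trans (+-monoʳ-≤ 2 (subst (B∩G.size ≤_) β⁺≡2 ∣B∩G∣≤β⁺)) (≤-reflexive (sym ∣A∩G∣+∣B∩G∣))))
      ∣B∩G∣≡2 : B∩G.size ≡ 2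
      ∣B∩G∣≡2 = ∣B∩G∣≡4∸∣A∩G∣ ∣A∩G∣≡2
      adj-v : ∀ j → j ≢ v → Adj E v j
      adj-v = v-adj-all (≤-reflexive (cong₂ _+_ α⁺≡2 β⁺≡2)) ∣A∩G∣≡2 ∣B∩G∣≡2
      rowV≥2 : 2 ≤ rowV
      rowV≥2 = ≤-trans (slackAt≥2 v) (≤-reflexive (sum-cong-≗ (𝟙≢-cong₁ v (λ j v≢j → sym (adjSlack-adj v j (adj-v j (v≢j ∘ sym)))))))

  module LoneVertex {v : Fin 9} (sp : Split v) {a₀ : Fin 9} (a₀∈A : a₀ ∈ Split.A sp) (a₀-lone : ¬ AtSplit.Bridged sp a₀) where
    open AtSplit sp

    v∈edge-to-B : ∀ {e y} → e ∈ˡ E → a₀ ∈ e → y ∈ B → y ∈ e → v ∈ e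
    v∈edge-to-B {e} {y} e∈E a₀∈e y∈B y∈e = decidable-stable (v ∈? e) λ v∉e →
      a₀-lone (e , ∈E∖⁺ e∈E v∉e , a₀∈e , (a₀ , a₀∈A , a₀∈e) , (y , y∈B , y∈e))

    codeg≥2-via : ∀ {e x} → e ∈ˡ E → v ∈ e → x ∈ e → a₀ ∉ e → x ∈ B → Adj E a₀ x → 2 ≤ codeg v x
    codeg≥2-via {e} {x} e∈E v∈e x∈e a₀∉e x∈B (e′ , e′∈E , a₀∈e′ , x∈e′) =
      two∈⇒count≥2 (λ e → (v ∈? e) ×-dec (x ∈? e)) e∈E e′∈E (λ { refl → a₀∉e a₀∈e′ })
                   (v∈e , x∈e) (v∈edge-to-B e′∈E a₀∈e′ x∈B x∈e′ , x∈e′)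

    codeg-v-a₀≥2 : (∀ y → y ≢ a₀ → Adj E a₀ y) → 2 ≤ codeg v a₀
    codeg-v-a₀≥2 adj-all =
      let (e₁ , e₁∈E , a₀∈e₁ , q∈e₁) = adj-all q (∈A∈B⇒≢ a₀∈A q∈B ∘ sym)
          (y , y∈B , y∉e₁) = ∃∈∖ (trans (edge-size B∈E) (sym (edge-size e₁∈E))) a₀∈e₁ (∈A⇒∉B a₀∈A)
          (e₂ , e₂∈E , a₀∈e₂ , y∈e₂) = adj-all y (∈A∈B⇒≢ a₀∈A y∈B ∘ sym)
      in two∈⇒count≥2 (λ e → (v ∈? e) ×-dec (a₀ ∈? e)) e₁∈E e₂∈E (λ e₁≡e₂ → y∉e₁ (subst (y ∈_) (sym e₁≡e₂) y∈e₂))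
                      (v∈edge-to-B e₁∈E a₀∈e₁ q∈B q∈e₁ , a₀∈e₁) (v∈edge-to-B e₂∈E a₀∈e₂ y∈B y∈e₂ , a₀∈e₂)

  module LonePair {v : Fin 9} (sp : Split v) {a₀ b₀ : Fin 9} (a₀∈A : a₀ ∈ Split.A sp) (b₀∈B : b₀ ∈ Split.B sp)
                  (a₀-lone : ¬ AtSplit.Bridged sp a₀) (b₀-lone : ¬ AtSplit.Bridged sp b₀) where
    open AtSplit sp
    private
      module Lone-a₀ = LoneVertex sp a₀∈A a₀-lone
      module Lone-b₀ = LoneVertex (Split-swap sp) b₀∈B (b₀-lone ∘ Bridged-swap sp)

    -- If slackAt v ≤ 2, every edge through v and b₀ contains a₀, so an edge through v missing a₀
    -- has a third vertex x with codeg v x ≥ 2, giving slack v a₀, slack v b₀, slack v x ≥ 1.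
    slackAt-v≥3 : (∀ y → y ≢ a₀ → Adj E a₀ y) → (∀ y → y ≢ b₀ → Adj E b₀ y) → 3 ≤ slackAt v
    slackAt-v≥3 adj-a₀ adj-b₀ = decidable-stable (3 ≤? slackAt v) λ ≱3 →
      let slackAt≤2 = ≤-pred (≰⇒> ≱3)
          b₀→a₀ = slackAt≤2⇒partner slackAt≤2 (a₀≢b₀ ∘ sym) v≢b₀ v≢a₀ slack-b₀≥1 slack-a₀≥1 codeg-b₀≥2
          (G′ , G′∈E , a₀∉G′ , v∈G′) = edge-avoiding a₀ v v≢a₀
          b₀∉G′ = λ b₀∈G′ → a₀∉G′ (b₀→a₀ G′∈E v∈G′ b₀∈G′)
          (x , χ≥1 , x≢v) = ∑≥2⇒∃≢ (χ G′) (χ≤1 G′) (≤-trans (s≤s (s≤s z≤n)) (≤-reflexive (sym (∑χ G′ (edge-size G′∈E))))) v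
          x∈G′ = 𝟙-pos (x ∈? G′) χ≥1
          x≢a₀ = λ x≡a₀ → a₀∉G′ (subst (_∈ G′) x≡a₀ x∈G′)
          x≢b₀ = λ x≡b₀ → b₀∉G′ (subst (_∈ G′) x≡b₀ x∈G′)
          codeg-x≥2 = [ (λ x∈A → Lone-b₀.codeg≥2-via G′∈E v∈G′ x∈G′ b₀∉G′ x∈A (adj-b₀ x x≢b₀)) ,
                        (λ x∈B → Lone-a₀.codeg≥2-via G′∈E v∈G′ x∈G′ a₀∉G′ x∈B (adj-a₀ x x≢a₀)) ]′ (A⊎B x x≢v)
          slack-x≥1 = codeg≥2⇒slack≥1 v x (x≢v ∘ sym) codeg-x≥2
      in contradiction (≤-trans (+-mono-≤ (+-mono-≤ slack-a₀≥1 slack-b₀≥1) slack-x≥1)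
                                (≤-trans (slack₃≤slackAt v a₀ b₀ x v≢a₀ v≢b₀ (x≢v ∘ sym) a₀≢b₀ (x≢a₀ ∘ sym) (x≢b₀ ∘ sym)) slackAt≤2))
                       λ { (s≤s (s≤s ())) }
      where
      a₀≢b₀ : a₀ ≢ b₀
      a₀≢b₀ = ∈A∈B⇒≢ a₀∈A b₀∈B
      v≢a₀ : v ≢ a₀
      v≢a₀ = ∈A⇒≢v a₀∈A ∘ sym
      v≢b₀ : v ≢ b₀
      v≢b₀ = ∈B⇒≢v b₀∈B ∘ sym
      codeg-b₀≥2 : 2 ≤ codeg v b₀
      codeg-b₀≥2 = Lone-b₀.codeg-v-a₀≥2 adj-b₀
      slack-a₀≥1 : 1 ≤ slack v a₀
      slack-a₀≥1 = codeg≥2⇒slack≥1 v a₀ v≢a₀ (Lone-a₀.codeg-v-a₀≥2 adj-a₀)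
      slack-b₀≥1 : 1 ≤ slack v b₀
      slack-b₀≥1 = codeg≥2⇒slack≥1 v b₀ v≢b₀ codeg-b₀≥2

    S≥19 : 19 ≤ S
    S≥19 = by-cases (nonadjacent? a₀) (nonadjacent? b₀)
      where
      nonadjacent? : ∀ x → Dec (∃[ y ] (y ≢ x × ¬ Adj E x y))
      nonadjacent? x = Fin.any? (λ y → ¬? (y ≟ x) ×-dec ¬? (adj? E x y))
      all-adj : ∀ {x} → ¬ (∃[ y ] (y ≢ x × ¬ Adj E x y)) → ∀ y → y ≢ x → Adj E x y
      all-adj {x} none y y≢x = decidable-stable (adj? E x y) (λ ¬adj → none (y , y≢x , ¬adj))
      by-cases : Dec (∃[ y ] (y ≢ a₀ × ¬ Adj E a₀ y)) → Dec (∃[ y ] (y ≢ b₀ × ¬ Adj E b₀ y)) → 19 ≤ S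
      by-cases (yes (y , y≢a₀ , ¬adj)) _ = ≤-trans (n≤1+n 19) (nonadj⇒S≥20 a₀ y y≢a₀ ¬adj)
      by-cases (no _) (yes (y , y≢b₀ , ¬adj)) = ≤-trans (n≤1+n 19) (nonadj⇒S≥20 b₀ y y≢b₀ ¬adj)
      by-cases (no none-a₀) (no none-b₀) = S≥slackAt+16 v (slackAt-v≥3 (all-adj none-a₀) (all-adj none-b₀))

  -- The vertex with most far pairs

  module _ {W₂ : ℕ} (W₂≡ : ∀ v → W₂ ≡ twiceW∖ v) (low≤W₂ : twiceW-low ≤ W₂) where

    deletion-identity : 9 * W₂ + S ≡ 9 * twiceW-low + X
    deletion-identity = begin
      9 * W₂ + S                              ≡⟨ cong (_+ S) (trans (sym (∑-const 9 W₂)) (sum-cong-≗ W₂≡)) ⟩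
      ∑ twiceW∖ + S                           ≡⟨ cong (_+ S) ∑twiceW∖ ⟩
      7 * twiceW-low + C + X + S              ≡⟨ solve 4 (λ l c x s → con 7 :* l :+ c :+ x :+ s := con 7 :* l :+ x :+ (s :+ c)) refl twiceW-low C X S ⟩
      7 * twiceW-low + X + (S + C)            ≡⟨ cong (7 * twiceW-low + X +_) S+C≡ ⟩
      7 * twiceW-low + X + 2 * twiceW-low     ≡⟨ solve 2 (λ l x → con 7 :* l :+ x :+ con 2 :* l := con 9 :* l :+ x) refl twiceW-low X ⟩
      9 * twiceW-low + X                      ∎
      where open ≡-Reasoning

    S≤X : S ≤ X
    S≤X = +-cancelˡ-≤ (9 * twiceW-low) S X (begin
      9 * twiceW-low + S   ≤⟨ +-monoˡ-≤ S (*-monoʳ-≤ 9 low≤W₂) ⟩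
      9 * W₂ + S           ≡⟨ deletion-identity ⟩
      9 * twiceW-low + X   ∎)
      where open ≤-Reasoning

    4L+M≤288+X : ∀ {L} → L ≤ W₂ → 4 * L + M ≤ 288 + X
    4L+M≤288+X {L} L≤W₂ = +-cancelʳ-≤ (360 + 9 * Z) (4 * L + M) (288 + X) (begin
      4 * L + M + (360 + 9 * Z)
        ≡⟨ solve 3 (λ l m z → con 4 :* l :+ m :+ (con 360 :+ con 9 :* z) := con 4 :* l :+ con 5 :* (z :+ con 72) :+ (con 4 :* z :+ m)) refl L M Z ⟩
      4 * L + 5 * (Z + 72) + (4 * Z + M)
        ≤⟨ +-monoˡ-≤ (4 * Z + M) (+-mono-≤ (*-monoʳ-≤ 4 L≤W₂) (*-monoʳ-≤ 5 (subst (_≤ W₂) twiceW-low≡ low≤W₂))) ⟩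
      4 * W₂ + 5 * W₂ + (4 * Z + M)
        ≡⟨ cong₂ _+_ (solve 1 (λ w → con 4 :* w :+ con 5 :* w := con 9 :* w) refl W₂) (sym S≡) ⟩
      9 * W₂ + S
        ≡⟨ deletion-identity ⟩
      9 * twiceW-low + X
        ≡⟨ cong (λ l → 9 * l + X) twiceW-low≡ ⟩
      9 * (Z + 72) + X
        ≡⟨ solve 2 (λ z x → con 9 :* (z :+ con 72) :+ x := con 288 :+ x :+ (con 360 :+ con 9 :* z)) refl Z X ⟩
      288 + X + (360 + 9 * Z)
        ∎)
      where open ≤-Reasoning

    X≤9X∖ : ∀ vmax → (∀ u → X∖ u ≤ X∖ vmax) → X ≤ 9 * X∖ vmax
    X≤9X∖ vmax max = begin
      X                         ≡⟨ X≡∑X∖ ⟩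
      ∑ X∖                      ≤⟨ ∑-mono max ⟩
      ∑ {9} (λ _ → X∖ vmax)     ≡⟨ ∑-const 9 (X∖ vmax) ⟩
      9 * X∖ vmax               ∎
      where open ≤-Reasoning

    module AtMax (vmax : Fin 9) (max : ∀ u → X∖ u ≤ X∖ vmax) where

      X∖≥1 : 1 ≤ X∖ vmax
      X∖≥1 = decidable-stable (1 ≤? X∖ vmax) λ X∖≱1 →
        ≰-by-computation (≤-trans S≥18 (≤-trans S≤X (≤-trans (X≤9X∖ vmax max) (≤-reflexive (cong (9 *_) (n<1⇒n≡0 (≰⇒> X∖≱1)))))))

      far-pair : ∃[ i ] ∃[ j ] (i ≢ vmax × j ≢ vmax × Far (E∖ vmax) i j)
      far-pair =
        let (i , j , _ , term≥1) = ∑≢-pos (λ i j → 𝟙≢ i vmax * 𝟙≢ j vmax * far∖ vmax i j) X∖≥1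
            (𝟙≢ᵢⱼ≥1 , far≥1) = *-pos⇒pos (𝟙≢ i vmax * 𝟙≢ j vmax) (far∖ vmax i j) term≥1
            (i≢v , j≢v) = *-pos⇒pos (𝟙≢ i vmax) (𝟙≢ j vmax) 𝟙≢ᵢⱼ≥1
        in i , j , 𝟙-pos (¬? (i ≟ vmax)) i≢v , 𝟙-pos (¬? (j ≟ vmax)) j≢v , 𝟙-pos (far? (E∖ vmax) i j) far≥1

      module SplitAtMax (sp : Split vmax) where
        open AtSplit sp

        split-bound : 64 + M ≤ 5 * X∖ vmax + 4 * (α⁺ * β⁺ + β⁺ * α⁺)
        split-bound = +-cancelˡ-≤ (288 + 4 * X∖ vmax) (64 + M) (5 * X∖ vmax + 4 * Pb) (begin
          288 + 4 * X∖ vmax + (64 + M)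
            ≡⟨ solve 2 (λ x m → con 288 :+ con 4 :* x :+ (con 64 :+ m) := con 4 :* (x :+ con 88) :+ m) refl (X∖ vmax) M ⟩
          4 * (X∖ vmax + 88) + M
            ≤⟨ +-monoˡ-≤ M (*-monoʳ-≤ 4 (subst (λ w → X∖ vmax + 88 ≤ w + Pb) (sym (W₂≡ vmax)) twiceW∖-lower)) ⟩
          4 * (W₂ + Pb) + M
            ≡⟨ solve 3 (λ w p m → con 4 :* (w :+ p) :+ m := con 4 :* w :+ m :+ con 4 :* p) refl W₂ Pb M ⟩
          4 * W₂ + M + 4 * Pb
            ≤⟨ +-monoˡ-≤ (4 * Pb) (≤-trans (4L+M≤288+X {W₂} ≤-refl) (+-monoʳ-≤ 288 {X} {9 * X∖ vmax} (X≤9X∖ vmax max))) ⟩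
          288 + 9 * X∖ vmax + 4 * Pb
            ≡⟨ solve 2 (λ x p → con 288 :+ con 9 :* x :+ con 4 :* p := con 288 :+ con 4 :* x :+ (con 5 :* x :+ con 4 :* p)) refl (X∖ vmax) Pb ⟩
          288 + 4 * X∖ vmax + (5 * X∖ vmax + 4 * Pb)
            ∎)
          where
          open ≤-Reasoning
          Pb : ℕ
          Pb = α⁺ * β⁺ + β⁺ * α⁺

        split-bound-at : ∀ a b → α ≡ a → β ≡ b →
                         64 + M ≤ 5 * (a * b + b * a) + 4 * ((4 ∸ a) * (4 ∸ b) + (4 ∸ b) * (4 ∸ a))
        split-bound-at a b α≡a β≡b =
          subst₂ (λ x p → 64 + M ≤ 5 * x + 4 * p) (trans X∖≡αβ (cong₂ (λ a b → a * b + b * a) α≡a β≡b))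
                 (cong₂ (λ a⁺ b⁺ → a⁺ * b⁺ + b⁺ * a⁺) (α⁺≡ α≡a) (β⁺≡ β≡b)) split-bound
          where
          α⁺≡ : ∀ {a} → α ≡ a → α⁺ ≡ 4 ∸ a
          α⁺≡ α≡a = trans (sym (m+n∸m≡n α α⁺)) (cong₂ _∸_ α+α⁺ α≡a)
          β⁺≡ : ∀ {b} → β ≡ b → β⁺ ≡ 4 ∸ b
          β⁺≡ β≡b = trans (sym (m+n∸m≡n β β⁺)) (cong₂ _∸_ β+β⁺ β≡b)

        no-1-2 : α ≡ 1 → β ≡ 2 → ⊥
        no-1-2 α≡1 β≡2 = ≰-by-computation (≤-trans (+-monoʳ-≤ 64 (SplitOverlaps.M≥6 sp α⁺≡3 β⁺≡2)) (split-bound-at 1 2 α≡1 β≡2))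
          where
          α⁺≡3 : α⁺ ≡ 3
          α⁺≡3 = +-cancelˡ-≡ 1 α⁺ 3 (trans (cong (_+ α⁺) (sym α≡1)) α+α⁺)
          β⁺≡2 : β⁺ ≡ 2
          β⁺≡2 = +-cancelˡ-≡ 2 β⁺ 2 (trans (cong (_+ β⁺) (sym β≡2)) β+β⁺)

        no-2-2 : α ≡ 2 → β ≡ 2 → ⊥
        no-2-2 α≡2 β≡2 = ≰-by-computation (≤-trans (+-monoʳ-≤ 64 (SplitOverlaps.M≥10 sp α⁺≡2 β⁺≡2)) (split-bound-at 2 2 α≡2 β≡2))
          where
          α⁺≡2 : α⁺ ≡ 2
          α⁺≡2 = +-cancelˡ-≡ 2 α⁺ 2 (trans (cong (_+ α⁺) (sym α≡2)) α+α⁺)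
          β⁺≡2 : β⁺ ≡ 2
          β⁺≡2 = +-cancelˡ-≡ 2 β⁺ 2 (trans (cong (_+ β⁺) (sym β≡2)) β+β⁺)

      -- With X∖ vmax = 2αβ, α⁺ = 4 − α and β⁺ = 4 − β, split-bound is numerically impossible
      -- except for (α, β) ∈ {(1,1), (1,2), (2,2)}, refuted by S ≥ 19, M ≥ 6 and M ≥ 10.
      no-split : (sp : Split vmax) → ∀ {i j} → i ∈ Split.A sp → j ∈ Split.B sp →
                 ¬ AtSplit.Bridged sp i → ¬ AtSplit.Bridged sp j → ⊥
      no-split sp {i} {j} i∈A j∈B i-lone j-lone = dispatch α β refl refl
        where
        open AtSplit sp
        open SplitAtMax sp
        α≥1 : 1 ≤ α
        α≥1 = ≤-trans (≤-reflexive (sym (trans (χ*-∈ (𝟙lone i) i∈A) (𝟙-yes (¬? (bridged? i)) i-lone)))) (term≤∑ loneA i)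
        β≥1 : 1 ≤ β
        β≥1 = ≤-trans (≤-reflexive (sym (trans (χ*-∈ (𝟙lone j) j∈B) (𝟙-yes (¬? (bridged? j)) j-lone)))) (term≤∑ loneB j)
        no-1-1 : α ≡ 1 → β ≡ 1 → ⊥
        no-1-1 α≡1 β≡1 = ≰-by-computation (begin
          19             ≤⟨ LonePair.S≥19 sp i∈A j∈B i-lone j-lone ⟩
          S              ≤⟨ S≤X ⟩
          X              ≤⟨ X≤9X∖ vmax max ⟩
          9 * X∖ vmax    ≡⟨ cong (9 *_) (trans X∖≡αβ (cong₂ (λ a b → a * b + b * a) α≡1 β≡1)) ⟩
          18             ∎)
          where open ≤-Reasoning
        too-big : ∀ {a b} → 5 ≤ a + b → α ≡ a → β ≡ b → ⊥
        too-big 5≤a+b α≡a β≡b = ≰-by-computation (≤-trans 5≤a+b (subst₂ (λ a b → a + b ≤ 4) α≡a β≡b α+β≤4))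
        dispatch : ∀ a b → α ≡ a → β ≡ b → ⊥
        dispatch 0       _       α≡0 _   = ≰-by-computation (subst (1 ≤_) α≡0 α≥1)
        dispatch (suc _) 0       _   β≡0 = ≰-by-computation (subst (1 ≤_) β≡0 β≥1)
        dispatch 1 1 = no-1-1
        dispatch 1 2 = no-1-2
        dispatch 2 1 α≡2 β≡1 = SplitAtMax.no-1-2 (Split-swap sp) (trans (α-swap sp) β≡1) (trans (β-swap sp) α≡2)
        dispatch 1 3 α≡1 β≡3 = ≰-by-computation (m+n≤o⇒m≤o 64 (split-bound-at 1 3 α≡1 β≡3))
        dispatch 3 1 α≡3 β≡1 = ≰-by-computation (m+n≤o⇒m≤o 64 (split-bound-at 3 1 α≡3 β≡1))
        dispatch 2 2 = no-2-2
        dispatch 1 (suc (suc (suc (suc b)))) = too-big (s≤s (s≤s (s≤s (s≤s (s≤s z≤n)))))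
        dispatch 2 (suc (suc (suc b)))       = too-big (s≤s (s≤s (s≤s (s≤s (s≤s z≤n)))))
        dispatch 3 (suc (suc b))             = too-big (s≤s (s≤s (s≤s (s≤s (s≤s z≤n)))))
        dispatch (suc (suc (suc (suc a)))) (suc b) =
          too-big (s≤s (s≤s (s≤s (s≤s (≤-trans (s≤s z≤n) (m≤n+m (suc b) a))))))

      contradiction-at-max : ⊥
      contradiction-at-max =
        let (i , j , i≢v , j≢v , far) = far-pair
            (sp , i∈A , j∈B) = far⇒split vmax i j i≢v j≢v far
            (i-lone , j-lone) = AtSplit.far⇒lone sp i∈A j∈B far
        in no-split sp i∈A j∈B i-lone j-lone

    no-Soltes : ⊥
    no-Soltes = let (vmax , max) = argmax X∖ in AtMax.contradiction-at-max vmax max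

mainTheorem7 : (E : Hyperedges 9) → Unique E → Uniform E 4 → ¬ Soltes E
mainTheorem7 E E-unique E-uniform (_ , H-Wiener , H∖-Wiener) =
  no-Soltes (λ v → twiceW∖≡ v (H∖-Wiener v)) (twiceW-low≤ H-Wiener)
  where
  E∖-connected : ∀ v x y → x ≢ v → y ≢ v → ∃[ ℓ ] Walk (deleteEdges v E) x y ℓ
  E∖-connected v x y x≢v y≢v =
    let (d , isDist , _) = H∖-Wiener v
    in d x y , proj₁ (isDist x y (∈-otherVertices⁺ x≢v) (∈-otherVertices⁺ y≢v))
  open VertexDeletions E E-unique E-uniform E∖-connected
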